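{- Let $\phi=\frac{\sqrt5+1}{2}$. (i) For the paths $P_n$ (vertex set $\{1,\ldots,n\}$, edges $(1,2),\ldots,(n-1,n)$), $\lim_{n\to\infty} \frac{f_{11}}{\sum_{i\ne1} f_{1i}}=\phi$. (ii) For the graphs $T_n$ (vertex set $\{1,\ldots,n\}$, edges $(1,3),(2,3),(3,4),\ldots,(n-1,n)$), $\lim_{n\to\infty} \frac{f_{nn}}{\sum_{i\ne n} f_{ni}}=\phi$ and $\lim_{n\to\infty} \frac{\sum_{i\ne3} f_{3i}}{f_{33}}=\phi$.
   Context: A spanning rooted forest of a graph is a spanning acyclic subgraph in which exactly one vertex (the root) is marked in each tree. For vertices $i,j$ of a graph, $f_{ij}$ is the number of its spanning rooted forests in which $i$ and $j$ lie in the same tree and that tree is rooted at $i$. -}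

module Defs where

open import Data.Nat using (ℕ; zero; suc; _≥_) renaming (_<_ to _<ℕ_)
open import Data.Fin using (Fin; zero; suc; inject₁; _≟_; fromℕ)
open import Data.Fin.Subset using (Subset; _∈_)
open import Data.List using (List; []; _∷_; length; lookup; tabulate; map; filter; allFin)
open import Data.Nat.ListAction using (sum)
open import Data.List.Relation.Unary.Unique.Propositional using (Unique)
import Data.List.Membership.Propositional as LM
open import Data.Product using (Σ; ∃; ∃-syntax; _×_; _,_)
open import Data.Sum using (_⊎_)
open import Data.Integer using (+_)
open import Data.Rational using (ℚ; _/_; _<_; _≤_; _*_; _+_; 0ℚ; 1ℚ)
open import Relation.Binary.PropositionalEquality using (_≡_; _≢_)
open import Relation.Nullary using (¬_; ¬?)
open import Function.Bundles using (_⇔_)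

-- Finite simple graphs on vertex set Fin n, given by a list of edges.
-- (Vertex k of the paper, 1 ≤ k ≤ n, is the element k-1 of Fin n.)

record Graph (n : ℕ) : Set where
  constructor graph
  field
    edges : List (Fin n × Fin n)

open Graph public

Edge : ∀ {n} → Graph n → Set
Edge G = Fin (length (edges G))

endpoints : ∀ {n} (G : Graph n) → Edge G → Fin n × Fin n
endpoints G e = lookup (edges G) e

Joins : ∀ {n} (G : Graph n) → Edge G → Fin n → Fin n → Set
Joins G e u v = endpoints G e ≡ (u , v) ⊎ endpoints G e ≡ (v , u)

SpanSub : ∀ {n} → Graph n → Set
SpanSub G = Subset (length (edges G))

data Walk {n} (G : Graph n) (S : SpanSub G) : Fin n → Fin n → List (Edge G) → Set where
  nil  : ∀ {u} → Walk G S u u []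
  cons : ∀ {u w v es} (e : Edge G) → e ∈ S → Joins G e u w →
         Walk G S w v es → Walk G S u v (e ∷ es)

Connected : ∀ {n} (G : Graph n) → SpanSub G → Fin n → Fin n → Set
Connected G S u v = ∃[ es ] Walk G S u v es

-- S is acyclic: it contains no cycle, i.e. no nonempty closed trail
-- (closed walk with pairwise distinct edges).
Acyclic : ∀ {n} (G : Graph n) → SpanSub G → Set
Acyclic G S = ∀ u es → Walk G S u u es → Unique es → es ≡ []

-- Spanning rooted forests: an acyclic spanning subgraph S together with a
-- set R of marked vertices (roots) such that each tree (component)
-- contains exactly one root.

Candidate : ∀ {n} → Graph n → Set
Candidate {n} G = SpanSub G × Subset n

IsRootedForest : ∀ {n} (G : Graph n) → Candidate G → Set
IsRootedForest {n} G (S , R) =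
  Acyclic G S ×
  (∀ (v : Fin n) → ∃[ r ] (r ∈ R × Connected G S v r ×
        (∀ r′ → r′ ∈ R → Connected G S v r′ → r′ ≡ r)))

IsForestIJ : ∀ {n} (G : Graph n) → Fin n → Fin n → Candidate G → Set
IsForestIJ G i j (S , R) =
  IsRootedForest G (S , R) × Connected G S i j × i ∈ R

IsCount : {A : Set} → (A → Set) → ℕ → Set
IsCount {A} P k =
  Σ (List A) λ xs → Unique xs × length xs ≡ k × (∀ x → (x LM.∈ xs) ⇔ P x)

IsFIJ : ∀ {n} → Graph n → Fin n → Fin n → ℕ → Set
IsFIJ G i j k = IsCount (IsForestIJ G i j) k

sumExcept : ∀ {n} → Fin n → (Fin n → ℕ) → ℕ
sumExcept {n} i g = sum (map g (filter (λ j → ¬? (j ≟ i)) (allFin n)))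

pathGraph : (n : ℕ) → Graph n
pathGraph zero = graph []
pathGraph (suc m) = graph (tabulate {n = m} (λ i → (inject₁ i , suc i)))

-- T_n (n ≥ 3) : edges (1,3),(2,3),(3,4),…,(n-1,n).  Indexed by m = n - 3.
TGraph : (m : ℕ) → Graph (3 Data.Nat.+ m)
TGraph m = graph ( (zero , suc (suc zero))
                 ∷ (suc zero , suc (suc zero))
                 ∷ tabulate {n = m} (λ i → (suc (suc (inject₁ i)) , suc (suc (suc i)))))

-- The golden ratio φ = (√5+1)/2, via its Dedekind cut in ℚ:
-- p < φ  iff  p ≤ 0 or p² < p + 1 ;   φ < q  iff  q > 0 and q + 1 < q².

BelowPhi : ℚ → Set
BelowPhi p = p ≤ 0ℚ ⊎ p * p < p + 1ℚ

AbovePhi : ℚ → Set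
AbovePhi q = 0ℚ < q × q + 1ℚ < q * q

toℚ : ℕ → ℚ
toℚ k = (+ k) / 1

RatioTendsToPhi : (ℕ → ℕ) → (ℕ → ℕ) → Set
RatioTendsToPhi a b =
  ∀ p q → BelowPhi p → AbovePhi q →
  ∃[ N ] ∀ n → n ≥ N →
    (0 <ℕ b n) × (p * toℚ (b n) < toℚ (a n)) × (toℚ (a n) < q * toℚ (b n))

module Submission where

open import Defs

-- Let the tree G′ arise from a tree G by attaching a new leaf x to a vertex y, and let R count
-- spanning rooted forests. A rooted forest of G′ either leaves x alone as its own root, or contains
-- the edge xy; then the tree of x and y keeps its root from G, or is rooted at x instead of y. Hence
--   f_xx(G′) = R(G) + f_yy(G),   f_xj(G′) = f_yj(G),   R(G′) = 2 R(G) + f_yy(G),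
--   f_yx(G′) = f_yy(G),          f_yj(G′) = 2 f_yj(G)   (j in G).
-- Growing P_n and T_n leaf by leaf, a = f_xx and b = Σ_{j≠x} f_xj at the newest vertex x satisfy
-- R = a + b, a′ = 2a + b and b′ = a + b, and the pair (Σ_{i≠3} f_3i, f_33) of T_n is 4(a + b, a) for
-- the path. Such a recurrence keeps a² − ab − b² constant while b → ∞, so a/b → φ by the identity
--   (qa − pb)(qa − qb + pb) = q²(a² − ab − b²) − b²(p² − pq − q²):
-- if a/b ≤ p/q < φ or φ < p/q ≤ a/b, its two sides force b² ≤ q² |a² − ab − b²|.

module Counting where

  open import Data.Nat using (ℕ; _+_)
  open import Data.List using (List; []; _∷_; map; _++_)
  open import Data.List.Properties using (length-++; length-map)
  open import Data.List.Relation.Unary.All as All using (All; []; _∷_)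
  open import Data.List.Relation.Unary.AllPairs using ([]; _∷_)
  open import Data.List.Relation.Unary.Any using (here; there)
  open import Data.List.Relation.Unary.Unique.Propositional using (Unique)
  import Data.List.Relation.Unary.Unique.Propositional.Properties as Unique
  open import Data.List.Membership.Propositional using (_∈_)
  open import Data.List.Membership.Propositional.Properties using (∈-++⁻; ∈-++⁺ˡ; ∈-++⁺ʳ; ∈-map⁺; ∈-map⁻)
  open import Data.List.Membership.Propositional.Properties.WithK using (unique∧set⇒bag)
  open import Data.List.Relation.Binary.BagAndSetEquality using (∼bag⇒↭)
  open import Data.List.Relation.Binary.Permutation.Propositional using (_↭_)
  open import Data.List.Relation.Binary.Permutation.Propositional.Properties using (↭-length)
  open import Data.Product using (∃-syntax; _×_; _,_)
  open import Data.Sum using (_⊎_; inj₁; inj₂)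
  import Data.Sum as Sum
  open import Data.Empty using (⊥)
  open import Relation.Binary.PropositionalEquality
  open import Function using (_∘_)
  open import Function.Bundles using (_⇔_; mk⇔; Equivalence)
  import Function.Properties.Equivalence as ⇔

  open Equivalence

  private variable
    A B : Set
    P Q : A → Set
    k l : ℕ

  InjectiveOn : (A → Set) → (A → B) → Set
  InjectiveOn Q f = ∀ {a a′} → Q a → Q a′ → f a ≡ f a′ → a ≡ a′

  Image : (A → Set) → (A → B) → B → Set
  Image Q f b = ∃[ a ] (Q a × f a ≡ b)

  ↭-by-members : ∀ {xs ys : List A} → Unique xs → Unique ys → (∀ z → z ∈ xs ⇔ z ∈ ys) → xs ↭ ys
  ↭-by-members xs! ys! xs⇔ys = ∼bag⇒↭ (unique∧set⇒bag xs! ys! λ {z} → xs⇔ys z)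

  count-unique : IsCount P k → IsCount P l → k ≡ l
  count-unique (xs , xs! , refl , xs⇔P) (ys , ys! , refl , ys⇔P) =
    ↭-length (↭-by-members xs! ys! λ z → ⇔.trans (xs⇔P z) (⇔.sym (ys⇔P z)))

  count-⇔ : IsCount P k → (∀ a → P a ⇔ Q a) → IsCount Q k
  count-⇔ (xs , xs! , |xs| , xs⇔P) P⇔Q = xs , xs! , |xs| , λ a → ⇔.trans (xs⇔P a) (P⇔Q a)

  count-single : (a₀ : A) → IsCount (_≡ a₀) 1
  count-single a₀ = a₀ ∷ [] , [] ∷ [] , refl , λ a → mk⇔ (λ { (here a≡a₀) → a≡a₀ ; (there ()) }) here

  private
    map-unique : (f : A → B) → ∀ {xs} → All Q xs → InjectiveOn Q f → Unique xs → Unique (map f xs)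
    map-unique f [] f-inj [] = []
    map-unique {Q = Q} f {x ∷ xs} (qx ∷ qxs) f-inj (x∉xs ∷ xs!) = fresh qxs x∉xs ∷ map-unique f qxs f-inj xs!
      where
      fresh : ∀ {ys} → All Q ys → All (x ≢_) ys → All (f x ≢_) (map f ys)
      fresh []           []           = []
      fresh (qy ∷ qys) (x≢y ∷ x≢ys) = (x≢y ∘ f-inj qx qy) ∷ fresh qys x≢ys

  count-image : (f : A → B) → IsCount Q k → InjectiveOn Q f → IsCount (Image Q f) k
  count-image f (xs , xs! , refl , xs⇔Q) f-inj =
    map f xs ,
    map-unique f (All.tabulate λ {z} → to (xs⇔Q z)) f-inj xs! ,
    length-map f xs ,
    λ b → mk⇔ (λ b∈ → let (a , a∈ , b≡fa) = ∈-map⁻ f b∈ in a , to (xs⇔Q a) a∈ , sym b≡fa)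
              (λ { (a , qa , refl) → ∈-map⁺ f (from (xs⇔Q a) qa) })

  count-⊎ : IsCount P k → IsCount Q l → (∀ a → P a → Q a → ⊥) → IsCount (λ a → P a ⊎ Q a) (k + l)
  count-⊎ (xs , xs! , refl , xs⇔P) (ys , ys! , refl , ys⇔Q) disjoint =
    xs ++ ys ,
    Unique.++⁺ xs! ys! (λ {z} (z∈xs , z∈ys) → disjoint z (to (xs⇔P z) z∈xs) (to (ys⇔Q z) z∈ys)) ,
    length-++ xs ,
    λ a → mk⇔ (Sum.map (to (xs⇔P a)) (to (ys⇔Q a)) ∘ ∈-++⁻ xs)
              (Sum.[ ∈-++⁺ˡ ∘ from (xs⇔P a) , ∈-++⁺ʳ xs ∘ from (ys⇔Q a) ])

  count-onto : ∀ {R : B → Set} (f : A → B) → IsCount Q k → InjectiveOn Q f →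
               (∀ a → Q a → R (f a)) → (∀ b → R b → Image Q f b) → IsCount R k
  count-onto f count f-inj into onto =
    count-⇔ (count-image f count f-inj) λ b → mk⇔ (λ { (a , qa , refl) → into a qa }) (onto b)

  count-onto₂ : ∀ {R : B → Set} (f g : A → B) → IsCount P k → IsCount Q l →
                InjectiveOn P f → InjectiveOn Q g → (∀ a a′ → f a ≢ g a′) →
                (∀ a → P a → R (f a)) → (∀ a → Q a → R (g a)) →
                (∀ b → R b → Image P f b ⊎ Image Q g b) → IsCount R (k + l)
  count-onto₂ f g countP countQ f-inj g-inj f≢g intoP intoQ onto =
    count-⇔ (count-⊎ (count-image f countP f-inj) (count-image g countQ g-inj)
                     λ { b (a , _ , refl) (a′ , _ , ga′≡fa) → f≢g a a′ (sym ga′≡fa) })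
            λ b → mk⇔ (λ { (inj₁ (a , pa , refl)) → intoP a pa ; (inj₂ (a , qa , refl)) → intoQ a qa }) (onto b)

module Connectivity where

  open import Data.List using ([]; _++_; [_])
  open import Data.Product using (_,_)
  open import Data.Sum using (inj₁; inj₂)

  module _ {n} {G : Graph n} {S : SpanSub G} where

    Joins-sym : ∀ {e u v} → Joins G e u v → Joins G e v u
    Joins-sym (inj₁ e≡uv) = inj₂ e≡uv
    Joins-sym (inj₂ e≡vu) = inj₁ e≡vu

    walk-++ : ∀ {u v w es fs} → Walk G S u v es → Walk G S v w fs → Walk G S u w (es ++ fs)
    walk-++ nil               w′ = w′
    walk-++ (cons e e∈S j w) w′ = cons e e∈S j (walk-++ w w′)

    walk-reverse : ∀ {u v es} → Walk G S u v es → Connected G S v u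
    walk-reverse nil = [] , nil
    walk-reverse (cons e e∈S j w) with walk-reverse w
    ... | fs , w⁻¹ = fs ++ [ e ] , walk-++ w⁻¹ (cons e e∈S (Joins-sym j) nil)

    connected-refl : ∀ {u} → Connected G S u u
    connected-refl = [] , nil

    connected-sym : ∀ {u v} → Connected G S u v → Connected G S v u
    connected-sym (_ , w) = walk-reverse w

    connected-trans : ∀ {u v w} → Connected G S u v → Connected G S v w → Connected G S u w
    connected-trans (_ , w) (_ , w′) = _ , walk-++ w w′

module RootedForests where

  open import Data.Bool using (Bool; true)
  open import Data.Fin using (Fin)
  open import Data.Fin.Subset using (Subset)
  open import Data.Vec using (lookup)
  open import Data.Vec.Properties using ([]=⇒lookup; lookup⇒[]=)
  open import Data.Product using (∃-syntax; _×_; _,_)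
  open import Relation.Binary.PropositionalEquality using (_≡_)

  AcyclicGraph : ∀ {n} → Graph n → Set
  AcyclicGraph G = ∀ S → Acyclic G S

  UniqueRoot : ∀ {n} (G : Graph n) → SpanSub G → (Fin n → Bool) → Set
  UniqueRoot {n} G S ρ =
    ∀ v → ∃[ r ] (ρ r ≡ true × Connected G S v r × (∀ r′ → ρ r′ ≡ true → Connected G S v r′ → r′ ≡ r))

  module _ {n} {G : Graph n} {S : SpanSub G} {R : Subset n} where

    rootedForest⇒uniqueRoot : IsRootedForest G (S , R) → UniqueRoot G S (lookup R)
    rootedForest⇒uniqueRoot (_ , roots) v with roots v
    ... | r , r∈R , v~r , unique =
      r , []=⇒lookup r∈R , v~r , λ r′ r′∈R v~r′ → unique r′ (lookup⇒[]= r′ R r′∈R) v~r′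

    uniqueRoot⇒rootedForest : Acyclic G S → UniqueRoot G S (lookup R) → IsRootedForest G (S , R)
    uniqueRoot⇒rootedForest acyclic roots = acyclic , λ v →
      let (r , r∈R , v~r , unique) = roots v
      in r , lookup⇒[]= r R r∈R , v~r , λ r′ r′∈R v~r′ → unique r′ ([]=⇒lookup r′∈R) v~r′


module OnePointExtensions where

  open import Data.Nat using (ℕ)
  open import Data.Bool using (Bool)
  open import Data.Fin using (Fin)
  open import Data.Vec using (Vec; lookup; tabulate)
  open import Data.Vec.Properties using (lookup∘tabulate; tabulate∘lookup; tabulate-cong)
  open import Data.Product using (∃-syntax; _×_; _,_)
  open import Data.Sum using (_⊎_; inj₁; inj₂; [_,_]′)
  open import Data.Empty using (⊥-elim)
  open import Relation.Binary.PropositionalEquality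

  vec-ext : ∀ {A : Set} {k} {v w : Vec A k} → (∀ i → lookup v i ≡ lookup w i) → v ≡ w
  vec-ext {v = v} {w} v≗w = trans (sym (tabulate∘lookup v)) (trans (tabulate-cong v≗w) (tabulate∘lookup w))

  record OnePointExtension (k k′ : ℕ) : Set where
    field
      embed : Fin k → Fin k′
      new : Fin k′
      embed-injective : ∀ {i j} → embed i ≡ embed j → i ≡ j
      embed≢new : ∀ i → embed i ≢ new
      view : ∀ i → i ≡ new ⊎ ∃[ j ] i ≡ embed j

    private
      pick : Bool → Vec Bool k → Fin k′ → Bool
      pick b v i = [ (λ _ → b) , (λ (j , _) → lookup v j) ]′ (view i)

    extend : Bool → Vec Bool k → Vec Bool k′
    extend b v = tabulate (pick b v)

    restrict : Vec Bool k′ → Vec Bool k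
    restrict w = tabulate λ j → lookup w (embed j)

    lookup-extend-new : ∀ b v → lookup (extend b v) new ≡ b
    lookup-extend-new b v rewrite lookup∘tabulate (pick b v) new with view new
    ... | inj₁ _            = refl
    ... | inj₂ (j , new≡j) = ⊥-elim (embed≢new j (sym new≡j))

    lookup-extend-embed : ∀ b v j → lookup (extend b v) (embed j) ≡ lookup v j
    lookup-extend-embed b v j rewrite lookup∘tabulate (pick b v) (embed j) with view (embed j)
    ... | inj₁ j≡new     = ⊥-elim (embed≢new j j≡new)
    ... | inj₂ (j′ , eq) = cong (lookup v) (embed-injective (sym eq))

    extend-restrict : ∀ w → extend (lookup w new) (restrict w) ≡ w
    extend-restrict w = vec-ext λ i → case i (view i)
      where
      case : ∀ i → i ≡ new ⊎ ∃[ j ] i ≡ embed j → lookup (extend (lookup w new) (restrict w)) i ≡ lookup w i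
      case _ (inj₁ refl)       = lookup-extend-new (lookup w new) (restrict w)
      case _ (inj₂ (j , refl)) = trans (lookup-extend-embed (lookup w new) (restrict w) j)
                                       (lookup∘tabulate (λ j → lookup w (embed j)) j)

    extend-injective : ∀ {b b′ v v′} → extend b v ≡ extend b′ v′ → b ≡ b′ × v ≡ v′
    extend-injective {b} {b′} {v} {v′} eq =
      trans (sym (lookup-extend-new b v)) (trans (cong (λ w → lookup w new) eq) (lookup-extend-new b′ v′)) ,
      vec-ext λ j → trans (sym (lookup-extend-embed b v j))
                      (trans (cong (λ w → lookup w (embed j)) eq) (lookup-extend-embed b′ v′ j))


module Sums where

  open import Data.Nat using (ℕ; suc; _+_)
  open import Data.Nat.Properties using (+-commutativeSemigroup)
  open import Algebra.Properties.CommutativeSemigroup +-commutativeSemigroup using (interchange)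
  open import Data.Nat.ListAction using (sum)
  open import Data.Nat.ListAction.Properties using (sum-↭)
  open import Data.Fin using (Fin; _≟_)
  open import Data.List using (List; []; _∷_; map; filter; tabulate; allFin)
  open import Data.List.Properties using (map-tabulate; tabulate-cong; map-cong; map-∘)
  open import Data.List.Relation.Unary.All as All using (All)
  open import Data.List.Relation.Unary.AllPairs using (_∷_)
  open import Data.List.Relation.Unary.Any using (here; there)
  open import Data.List.Relation.Unary.Unique.Propositional using (Unique)
  import Data.List.Relation.Unary.Unique.Propositional.Properties as Unique
  open import Data.List.Membership.Propositional using (_∈_)
  open import Data.List.Membership.Propositional.Properties using (∈-allFin; ∈-filter⁺; ∈-filter⁻; ∈-map⁺; ∈-map⁻)
  open import Data.List.Relation.Binary.Permutation.Propositional using (_↭_)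
  import Data.List.Relation.Binary.Permutation.Propositional.Properties as ↭
  open import Data.Product using (∃-syntax; _,_; proj₂)
  open import Data.Sum using (_⊎_; inj₁; inj₂)
  open import Data.Empty using (⊥-elim)
  open import Relation.Nullary using (¬?; Dec; yes; no)
  open import Relation.Binary.PropositionalEquality
  open import Function.Bundles using (_⇔_; mk⇔)
  open Counting using (↭-by-members)
  open OnePointExtensions using (OnePointExtension)

  ∑ : ∀ {n} → (Fin n → ℕ) → ℕ
  ∑ f = sum (tabulate f)

  ∑-cong : ∀ {n} {f g : Fin n → ℕ} → (∀ i → f i ≡ g i) → ∑ f ≡ ∑ g
  ∑-cong f≗g = cong sum (tabulate-cong f≗g)

  others : ∀ {n} → Fin n → List (Fin n)
  others i = filter (λ j → ¬? (j ≟ i)) (allFin _)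

  others-unique : ∀ {n} (i : Fin n) → Unique (others i)
  others-unique {n} i = Unique.filter⁺ (λ j → ¬? (j ≟ i)) (Unique.allFin⁺ n)

  ∈-others⁺ : ∀ {n} {i j : Fin n} → j ≢ i → j ∈ others i
  ∈-others⁺ {i = i} {j} j≢i = ∈-filter⁺ (λ j → ¬? (j ≟ i)) (∈-allFin j) j≢i

  ∈-others⁻ : ∀ {n} {i j : Fin n} → j ∈ others i → j ≢ i
  ∈-others⁻ {n} {i} j∈ = proj₂ (∈-filter⁻ (λ j → ¬? (j ≟ i)) {xs = allFin n} j∈)

  sum-map-↭ : ∀ {A : Set} (g : A → ℕ) {xs ys} → xs ↭ ys → sum (map g xs) ≡ sum (map g ys)
  sum-map-↭ g xs↭ys = sum-↭ (↭.map⁺ g xs↭ys)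

  sum-map-+ : ∀ {A : Set} (g h : A → ℕ) xs → sum (map (λ z → g z + h z) xs) ≡ sum (map g xs) + sum (map h xs)
  sum-map-+ g h []       = refl
  sum-map-+ g h (x ∷ xs) =
    trans (cong ((g x + h x) +_) (sum-map-+ g h xs)) (interchange (g x) (h x) (sum (map g xs)) (sum (map h xs)))

  sumExcept-cong : ∀ {n} (i : Fin n) {g h : Fin n → ℕ} → (∀ j → g j ≡ h j) → sumExcept i g ≡ sumExcept i h
  sumExcept-cong i g≗h = cong sum (map-cong g≗h (others i))

  sumExcept-+ : ∀ {n} (i : Fin n) (g h : Fin n → ℕ) → sumExcept i (λ j → g j + h j) ≡ sumExcept i g + sumExcept i h
  sumExcept-+ i g h = sum-map-+ g h (others i)

  ∑-split : ∀ {n} (i : Fin n) (g : Fin n → ℕ) → ∑ g ≡ g i + sumExcept i g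
  ∑-split {n} i g = begin
    ∑ g                        ≡⟨ cong sum (map-tabulate (λ j → j) g) ⟨
    sum (map g (allFin n))     ≡⟨ sum-map-↭ g (↭-by-members (Unique.allFin⁺ n) i∷others-unique members) ⟩
    sum (map g (i ∷ others i)) ∎
    where
    open ≡-Reasoning
    i∷others-unique : Unique (i ∷ others i)
    i∷others-unique = All.tabulate (λ j∈ → ≢-sym (∈-others⁻ j∈)) ∷ others-unique i
    members : ∀ j → j ∈ allFin n ⇔ j ∈ i ∷ others i
    members j = mk⇔ (λ _ → by-cases (j ≟ i)) (λ _ → ∈-allFin j)
      where
      by-cases : Dec (j ≡ i) → j ∈ i ∷ others i
      by-cases (yes j≡i) = here j≡i
      by-cases (no j≢i)  = there (∈-others⁺ j≢i)

  module _ {n} (ext : OnePointExtension n (suc n)) where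

    open OnePointExtension ext

    private
      embed-unique : ∀ {xs} → Unique xs → Unique (map embed xs)
      embed-unique = Unique.map⁺ embed-injective

      new∉embed : ∀ {xs} → All (new ≢_) (map embed xs)
      new∉embed = All.tabulate λ z∈ new≡z →
        let (j , _ , z≡ej) = ∈-map⁻ embed z∈ in embed≢new j (sym (trans new≡z z≡ej))

    sumExcept-new : ∀ g → sumExcept new g ≡ ∑ (λ j → g (embed j))
    sumExcept-new g = begin
      sumExcept new g                  ≡⟨ sum-map-↭ g (↭-by-members (others-unique new) (embed-unique (Unique.allFin⁺ n)) members) ⟩
      sum (map g (map embed (allFin n))) ≡⟨ cong sum (trans (cong (map g) (map-tabulate (λ j → j) embed)) (map-tabulate embed g)) ⟩
      ∑ (λ j → g (embed j))            ∎
      where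
      open ≡-Reasoning
      members : ∀ z → z ∈ others new ⇔ z ∈ map embed (allFin n)
      members z = mk⇔ (λ z∈ → by-view (view z) (∈-others⁻ z∈))
                      (λ z∈ → let (j , _ , z≡ej) = ∈-map⁻ embed z∈ in
                              ∈-others⁺ λ z≡new → embed≢new j (trans (sym z≡ej) z≡new))
        where
        by-view : z ≡ new ⊎ ∃[ j ] z ≡ embed j → z ≢ new → z ∈ map embed (allFin n)
        by-view (inj₁ z≡new)      z≢new = ⊥-elim (z≢new z≡new)
        by-view (inj₂ (j , refl)) _     = ∈-map⁺ embed (∈-allFin j)

    sumExcept-embed : ∀ i g → sumExcept (embed i) g ≡ g new + sumExcept i (λ j → g (embed j))
    sumExcept-embed i g = begin
      sumExcept (embed i) g                     ≡⟨ sum-map-↭ g (↭-by-members (others-unique (embed i)) unique members) ⟩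
      sum (map g (new ∷ map embed (others i)))  ≡⟨ cong (λ xs → g new + sum xs) (map-∘ (others i)) ⟨
      g new + sumExcept i (λ j → g (embed j))   ∎
      where
      open ≡-Reasoning
      unique : Unique (new ∷ map embed (others i))
      unique = new∉embed ∷ embed-unique (others-unique i)
      members : ∀ z → z ∈ others (embed i) ⇔ z ∈ new ∷ map embed (others i)
      members z = mk⇔ (λ z∈ → by-view (view z) (∈-others⁻ z∈)) from′
        where
        by-view : z ≡ new ⊎ ∃[ j ] z ≡ embed j → z ≢ embed i → z ∈ new ∷ map embed (others i)
        by-view (inj₁ z≡new)      _      = here z≡new
        by-view (inj₂ (j , refl)) ej≢ei = there (∈-map⁺ embed (∈-others⁺ λ j≡i → ej≢ei (cong embed j≡i)))
        from′ : z ∈ new ∷ map embed (others i) → z ∈ others (embed i)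
        from′ (here refl) = ∈-others⁺ λ new≡ei → embed≢new i (sym new≡ei)
        from′ (there z∈)  = let (j , j∈ , z≡ej) = ∈-map⁻ embed z∈ in
          ∈-others⁺ λ z≡ei → ∈-others⁻ j∈ (embed-injective (trans (sym z≡ej) z≡ei))


module Pendants where

  open import Data.Nat using (ℕ; suc; _+_)
  open import Data.Bool using (Bool; true; false)
  open import Data.Bool.Properties using (¬-not)
  open import Data.Fin using (Fin; _≟_)
  open import Data.Fin.Subset using (Subset; _∈_)
  open import Data.Vec using (lookup; _[_]≔_)
  open import Data.Vec.Properties
    using ([]=⇒lookup; lookup⇒[]=; lookup∘tabulate; lookup∘update; lookup∘update′; []≔-idempotent; []≔-lookup)
  open import Data.List using (List; []; _∷_; map; length)
  open import Data.List.Relation.Unary.All using (_∷_)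
  open import Data.List.Relation.Unary.All.Properties using (All¬⇒¬Any)
  open import Data.List.Relation.Unary.AllPairs using (_∷_)
  open import Data.List.Relation.Unary.Any using (here; there)
  open import Data.List.Relation.Unary.Unique.Propositional using (Unique)
  import Data.List.Relation.Unary.Unique.Propositional.Properties as Unique
  import Data.List.Membership.Propositional as List
  open import Data.Product using (∃-syntax; _×_; _,_; proj₁; proj₂)
  open import Data.Sum using (_⊎_; inj₁; inj₂)
  open import Data.Empty using (⊥; ⊥-elim)
  open import Relation.Nullary using (¬_; yes; no)
  open import Relation.Binary.PropositionalEquality
  open import Function.Bundles using (_⇔_; mk⇔; Equivalence)
  open Equivalence
  open Counting
  open Connectivity
  open RootedForests
  open OnePointExtensions
  open Sums

  record Pendant {n} (G′ : Graph (suc n)) (G : Graph n) : Set where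
    field
      vertex-ext : OnePointExtension n (suc n)
      edge-ext   : OnePointExtension (length (edges G)) (length (edges G′))
    open OnePointExtension vertex-ext public using ()
      renaming (embed to ι; new to x; embed-injective to ι-injective; embed≢new to ι≢x; view to vertex-view)
    open OnePointExtension edge-ext public using ()
      renaming (embed to κ; new to ε; view to edge-view)
    field
      y : Fin n
      κ-endpoints : ∀ e → endpoints G′ (κ e) ≡ (ι (proj₁ (endpoints G e)) , ι (proj₂ (endpoints G e)))
      ε-joins : Joins G′ ε x (ι y)

  module Leaf {n} {G′ : Graph (suc n)} {G : Graph n} (P : Pendant G′ G) where

    open Pendant P

    retract : Fin (suc n) → Fin n
    retract v with vertex-view v
    ... | inj₁ _       = y
    ... | inj₂ (u , _) = u

    retract-x : retract x ≡ y
    retract-x with vertex-view x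
    ... | inj₁ _          = refl
    ... | inj₂ (u , x≡ιu) = ⊥-elim (ι≢x u (sym x≡ιu))

    retract-ι : ∀ u → retract (ι u) ≡ u
    retract-ι u with vertex-view (ι u)
    ... | inj₁ ιu≡x        = ⊥-elim (ι≢x u ιu≡x)
    ... | inj₂ (u′ , ιu≡ιu′) = ι-injective (sym ιu≡ιu′)

    κ-joins⁻ : ∀ {f a b} → Joins G′ (κ f) a b → ∃[ u ] ∃[ v ] (a ≡ ι u × b ≡ ι v × Joins G f u v)
    κ-joins⁻ {f} (inj₁ eq) = let e = trans (sym (κ-endpoints f)) eq in
      _ , _ , sym (cong proj₁ e) , sym (cong proj₂ e) , inj₁ refl
    κ-joins⁻ {f} (inj₂ eq) = let e = trans (sym (κ-endpoints f)) eq in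
      _ , _ , sym (cong proj₂ e) , sym (cong proj₁ e) , inj₂ refl

    κ-joins⁺ : ∀ {f u v} → Joins G f u v → Joins G′ (κ f) (ι u) (ι v)
    κ-joins⁺ {f} (inj₁ eq) = inj₁ (trans (κ-endpoints f) (cong (λ (u , v) → ι u , ι v) eq))
    κ-joins⁺ {f} (inj₂ eq) = inj₂ (trans (κ-endpoints f) (cong (λ (u , v) → ι u , ι v) eq))

    ε-joins⁻ : ∀ {a b} → Joins G′ ε a b → (a ≡ x × b ≡ ι y) ⊎ (a ≡ ι y × b ≡ x)
    ε-joins⁻ j with j | ε-joins
    ... | inj₁ p | inj₁ q = let e = trans (sym p) q in inj₁ (cong proj₁ e , cong proj₂ e)
    ... | inj₁ p | inj₂ q = let e = trans (sym p) q in inj₂ (cong proj₁ e , cong proj₂ e)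
    ... | inj₂ p | inj₁ q = let e = trans (sym p) q in inj₂ (cong proj₂ e , cong proj₁ e)
    ... | inj₂ p | inj₂ q = let e = trans (sym p) q in inj₁ (cong proj₂ e , cong proj₁ e)

    module Restriction (S′ : SpanSub G′) (S : SpanSub G) (S′∘κ≗S : ∀ f → lookup S′ (κ f) ≡ lookup S f) where

      κ∈⁻ : ∀ {f} → κ f ∈ S′ → f ∈ S
      κ∈⁻ {f} κf∈ = lookup⇒[]= f S (trans (sym (S′∘κ≗S f)) ([]=⇒lookup κf∈))

      κ∈⁺ : ∀ {f} → f ∈ S → κ f ∈ S′
      κ∈⁺ {f} f∈ = lookup⇒[]= (κ f) S′ (trans (S′∘κ≗S f) ([]=⇒lookup f∈))

      walk-retract : ∀ {a b es} → Walk G′ S′ a b es → Connected G S (retract a) (retract b)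
      walk-retract nil = connected-refl
      walk-retract {a} (cons {w = c} e e∈ j w) with edge-view e
      ... | inj₁ refl = subst (λ t → Connected G S t _) same-retract (walk-retract w)
        where
        same-retract : retract c ≡ retract a
        same-retract with ε-joins⁻ j
        ... | inj₁ (refl , refl) = trans (retract-ι y) (sym retract-x)
        ... | inj₂ (refl , refl) = trans retract-x (sym (retract-ι y))
      walk-retract (cons e e∈ j w) | inj₂ (f , refl) with κ-joins⁻ j
      ... | u , v , refl , refl , jf =
        let (fs , w′) = walk-retract w in
        subst (λ t → Connected G S t _) (sym (retract-ι u))
          (f ∷ fs , cons f (κ∈⁻ e∈) jf (subst (λ t → Walk G S t _ fs) (retract-ι v) w′))

      walk-lift : ∀ {u v fs} → Walk G S u v fs → Walk G′ S′ (ι u) (ι v) (map κ fs)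
      walk-lift nil              = nil
      walk-lift (cons f f∈ j w) = cons (κ f) (κ∈⁺ f∈) (κ-joins⁺ j) (walk-lift w)

      connected-lift : ∀ {u v} → Connected G S u v → Connected G′ S′ (ι u) (ι v)
      connected-lift (_ , w) = _ , walk-lift w

      connected-retract : ∀ {a b u v} → retract a ≡ u → retract b ≡ v → Connected G′ S′ a b → Connected G S u v
      connected-retract refl refl (_ , w) = walk-retract w

      connected-unlift : ∀ {u v} → Connected G′ S′ (ι u) (ι v) → Connected G S u v
      connected-unlift = connected-retract (retract-ι _) (retract-ι _)

      module Attached (ε∈S′ : lookup S′ ε ≡ true) where

        connected-to-retract : ∀ a → Connected G′ S′ a (ι (retract a))
        connected-to-retract a = by-view a (vertex-view a)
          where
          by-view : ∀ a → a ≡ x ⊎ ∃[ u ] a ≡ ι u → Connected G′ S′ a (ι (retract a))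
          by-view _ (inj₁ refl) = subst (λ t → Connected G′ S′ x (ι t)) (sym retract-x)
                                    (_ , cons ε (lookup⇒[]= ε S′ ε∈S′) ε-joins nil)
          by-view _ (inj₂ (u , refl)) = subst (λ t → Connected G′ S′ (ι u) (ι t)) (sym (retract-ι u)) connected-refl

        connected-unretract : ∀ {a b u v} → retract a ≡ u → retract b ≡ v → Connected G S u v → Connected G′ S′ a b
        connected-unretract {a} {b} refl refl a~b =
          connected-trans (connected-to-retract a)
            (connected-trans (connected-lift a~b) (connected-sym (connected-to-retract b)))

      module Isolated (ε∉S′ : lookup S′ ε ≡ false) where

        walk-from-x : ∀ {b es} → Walk G′ S′ x b es → b ≡ x
        walk-from-x nil = refl
        walk-from-x (cons e e∈ j w) with edge-view e
        ... | inj₁ refl with trans (sym ([]=⇒lookup e∈)) ε∉S′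
        ...   | ()
        walk-from-x (cons e e∈ j w) | inj₂ (f , refl) with κ-joins⁻ j
        ... | u , _ , x≡ιu , _ = ⊥-elim (ι≢x u (sym x≡ιu))

        x-isolated : ∀ {u} → ¬ Connected G′ S′ (ι u) x
        x-isolated {u} ιu~x = ι≢x u (walk-from-x (proj₂ (connected-sym ιu~x)))

      walk-into-x-uses-ε : ∀ {a es} → Walk G′ S′ a x es → a ≢ x → ε List.∈ es
      walk-into-x-uses-ε nil a≢x = ⊥-elim (a≢x refl)
      walk-into-x-uses-ε (cons e e∈ j w) a≢x with edge-view e
      ... | inj₁ refl = here refl
      ... | inj₂ (f , refl) with κ-joins⁻ j
      ...   | _ , v , _ , refl , _ = there (walk-into-x-uses-ε w (ι≢x v))

      trail-retract : ∀ {a b es} → Walk G′ S′ a b es → Unique es → a ≢ x → b ≢ x →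
                      ∃[ fs ] (Walk G S (retract a) (retract b) fs × map κ fs ≡ es)
      trail-retract nil _ _ _ = [] , nil , refl
      trail-retract (cons e e∈ j w) (_ ∷ es!) a≢x b≢x with edge-view e
      trail-retract (cons e e∈ j w) (_ ∷ es!) a≢x b≢x | inj₁ refl with ε-joins⁻ j
      ... | inj₁ (a≡x , _) = ⊥-elim (a≢x a≡x)
      ... | inj₂ (_ , refl) with w
      ...   | nil = ⊥-elim (b≢x refl)
      trail-retract (cons e e∈ j w) ((ε∉es ∷ _) ∷ _) a≢x b≢x | inj₁ refl | inj₂ (_ , refl) | cons e₂ _ j₂ _
        with edge-view e₂
      ...   | inj₁ refl = ⊥-elim (ε∉es refl)
      ...   | inj₂ (f , refl) with κ-joins⁻ j₂
      ...     | u , _ , x≡ιu , _ = ⊥-elim (ι≢x u (sym x≡ιu))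
      trail-retract (cons e e∈ j w) (_ ∷ es!) a≢x b≢x | inj₂ (f , refl) with κ-joins⁻ j
      ... | u , v , refl , refl , jf with trail-retract w es! (ι≢x v) b≢x
      ...   | fs , w′ , refl =
        f ∷ fs ,
        subst (λ t → Walk G S t _ (f ∷ fs)) (sym (retract-ι u))
          (cons f (κ∈⁻ e∈) jf (subst (λ t → Walk G S t _ fs) (retract-ι v) w′)) ,
        refl

      acyclic-lift : AcyclicGraph G → Acyclic G′ S′
      acyclic-lift acyclicG a es w es! with vertex-view a
      acyclic-lift acyclicG a [] w es! | inj₁ refl = refl
      acyclic-lift acyclicG a (e ∷ es) (cons e e∈ j w) (e∉es ∷ _) | inj₁ refl with edge-view e
      ... | inj₂ (f , refl) with κ-joins⁻ j
      ...   | u , _ , x≡ιu , _ = ⊥-elim (ι≢x u (sym x≡ιu))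
      acyclic-lift acyclicG a (e ∷ es) (cons e e∈ j w) (ε∉es ∷ _) | inj₁ refl | inj₁ refl with ε-joins⁻ j
      ... | inj₂ (x≡ιy , _) = ⊥-elim (ι≢x y (sym x≡ιy))
      ... | inj₁ (_ , refl) = ⊥-elim (All¬⇒¬Any ε∉es (walk-into-x-uses-ε w (ι≢x y)))
      acyclic-lift acyclicG a es w es! | inj₂ (v , refl) with trail-retract w es! (ι≢x v) (ι≢x v)
      ... | fs , w′ , refl = cong (map κ) (acyclicG S _ fs w′ (Unique.map⁻ es!))

      module RootsOf (ρ′ : Fin (suc n) → Bool) (ρ : Fin n → Bool) (ρ′∘ι≗ρ : ∀ u → ρ′ (ι u) ≡ ρ u) where

        module _ (ε∉S′ : lookup S′ ε ≡ false) where

          open Isolated ε∉S′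

          uniqueRoot-isolated⇒ : UniqueRoot G′ S′ ρ′ → ρ′ x ≡ true × UniqueRoot G S ρ
          uniqueRoot-isolated⇒ roots′ = x-root , roots
            where
            x-root : ρ′ x ≡ true
            x-root with roots′ x
            ... | r , ρ′r , (_ , x→r) , _ = subst (λ t → ρ′ t ≡ true) (walk-from-x x→r) ρ′r
            roots : UniqueRoot G S ρ
            roots u with roots′ (ι u)
            ... | r , ρ′r , u~r , unique with vertex-view r
            ...   | inj₁ refl       = ⊥-elim (x-isolated u~r)
            ...   | inj₂ (w , refl) = w , trans (sym (ρ′∘ι≗ρ w)) ρ′r , connected-unlift u~r ,
                      λ w′ ρw′ u~w′ → ι-injective (unique (ι w′) (trans (ρ′∘ι≗ρ w′) ρw′) (connected-lift u~w′))

          uniqueRoot-isolated⇐ : ρ′ x ≡ true → UniqueRoot G S ρ → UniqueRoot G′ S′ ρ′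
          uniqueRoot-isolated⇐ x-root roots a with vertex-view a
          ... | inj₁ refl = x , x-root , connected-refl , λ _ _ (_ , x→r′) → walk-from-x x→r′
          ... | inj₂ (u , refl) with roots u
          ...   | w , ρw , u~w , unique = ι w , trans (ρ′∘ι≗ρ w) ρw , connected-lift u~w , unique′
            where
            unique′ : ∀ r′ → ρ′ r′ ≡ true → Connected G′ S′ (ι u) r′ → r′ ≡ ι w
            unique′ r′ ρ′r′ u~r′ with vertex-view r′
            ... | inj₁ refl        = ⊥-elim (x-isolated u~r′)
            ... | inj₂ (w′ , refl) = cong ι (unique w′ (trans (sym (ρ′∘ι≗ρ w′)) ρ′r′) (connected-unlift u~r′))

        module _ (ε∈S′ : lookup S′ ε ≡ true) (ρ* : Fin n → Bool)
                 (ρ*-spec : ∀ w → ρ* w ≡ true ⇔ ((w ≡ y × ρ′ x ≡ true) ⊎ ρ w ≡ true)) where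

          open Attached ε∈S′

          private
            root-retract : ∀ r → ρ′ r ≡ true → ρ* (retract r) ≡ true
            root-retract r = by-view r (vertex-view r)
              where
              by-view : ∀ r → r ≡ x ⊎ ∃[ w ] r ≡ ι w → ρ′ r ≡ true → ρ* (retract r) ≡ true
              by-view _ (inj₁ refl) ρ′x =
                subst (λ t → ρ* t ≡ true) (sym retract-x) (from (ρ*-spec y) (inj₁ (refl , ρ′x)))
              by-view _ (inj₂ (w , refl)) ρ′ιw =
                subst (λ t → ρ* t ≡ true) (sym (retract-ι w)) (from (ρ*-spec w) (inj₂ (trans (sym (ρ′∘ι≗ρ w)) ρ′ιw)))

          uniqueRoot-attached⇒ : UniqueRoot G′ S′ ρ′ → ¬ (ρ′ x ≡ true × ρ y ≡ true) × UniqueRoot G S ρ*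
          uniqueRoot-attached⇒ roots′ = not-both , roots
            where
            not-both : ¬ (ρ′ x ≡ true × ρ y ≡ true)
            not-both (ρ′x , ρy) with roots′ x
            ... | _ , _ , _ , unique =
              ι≢x y (trans (unique (ι y) (trans (ρ′∘ι≗ρ y) ρy) (connected-unretract retract-x (retract-ι y) connected-refl))
                           (sym (unique x ρ′x connected-refl)))
            roots : UniqueRoot G S ρ*
            roots u with roots′ (ι u)
            ... | r , ρ′r , u~r , unique = retract r , root-retract r ρ′r , connected-retract (retract-ι u) refl u~r , unique*
              where
              unique* : ∀ w → ρ* w ≡ true → Connected G S u w → w ≡ retract r
              unique* w ρ*w u~w with to (ρ*-spec w) ρ*w
              ... | inj₁ (refl , ρ′x) =
                trans (sym retract-x) (cong retract (unique x ρ′x (connected-unretract (retract-ι u) retract-x u~w)))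
              ... | inj₂ ρw =
                trans (sym (retract-ι w))
                  (cong retract (unique (ι w) (trans (ρ′∘ι≗ρ w) ρw) (connected-unretract (retract-ι u) (retract-ι w) u~w)))

          uniqueRoot-attached⇐ : ¬ (ρ′ x ≡ true × ρ y ≡ true) → UniqueRoot G S ρ* → UniqueRoot G′ S′ ρ′
          uniqueRoot-attached⇐ not-both roots a with roots (retract a)
          ... | w , ρ*w , a~w , unique with to (ρ*-spec w) ρ*w
          ...   | inj₁ (refl , ρ′x) = x , ρ′x , connected-unretract refl retract-x a~w , unique′
            where
            unique′ : ∀ r′ → ρ′ r′ ≡ true → Connected G′ S′ a r′ → r′ ≡ x
            unique′ r′ ρ′r′ a~r′ with vertex-view r′
            ... | inj₁ refl = refl
            ... | inj₂ (w′ , refl) =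
              let ρw′ = trans (sym (ρ′∘ι≗ρ w′)) ρ′r′
                  w′≡y = unique w′ (from (ρ*-spec w′) (inj₂ ρw′)) (connected-retract refl (retract-ι w′) a~r′)
              in ⊥-elim (not-both (ρ′x , subst (λ t → ρ t ≡ true) w′≡y ρw′))
          ...   | inj₂ ρw = ι w , trans (ρ′∘ι≗ρ w) ρw , connected-unretract refl (retract-ι w) a~w , unique′
            where
            unique′ : ∀ r′ → ρ′ r′ ≡ true → Connected G′ S′ a r′ → r′ ≡ ι w
            unique′ r′ ρ′r′ a~r′ with vertex-view r′
            ... | inj₁ refl =
              let y≡w = unique y (from (ρ*-spec y) (inj₁ (refl , ρ′r′))) (connected-retract refl retract-x a~r′)
              in ⊥-elim (not-both (ρ′r′ , subst (λ t → ρ t ≡ true) (sym y≡w) ρw))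
            ... | inj₂ (w′ , refl) =
              cong ι (unique w′ (from (ρ*-spec w′) (inj₂ (trans (sym (ρ′∘ι≗ρ w′)) ρ′r′)))
                             (connected-retract refl (retract-ι w′) a~r′))

    private
      module V = OnePointExtension vertex-ext
      module E = OnePointExtension edge-ext

      false≢true : false ≢ true
      false≢true ()

    extend : Bool → Bool → Candidate G → Candidate G′
    extend s r (S , R) = E.extend s S , V.extend r R

    extend-injective : ∀ {s r c s′ r′ c′} → extend s r c ≡ extend s′ r′ c′ → s ≡ s′ × r ≡ r′ × c ≡ c′
    extend-injective {c = S , R} {c′ = S′ , R′} eq =
      let (s≡s′ , S≡S′) = E.extend-injective (cong proj₁ eq)
          (r≡r′ , R≡R′) = V.extend-injective (cong proj₂ eq)
      in s≡s′ , r≡r′ , cong₂ _,_ S≡S′ R≡R′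

    by-extension : (Z : Candidate G′ → Set) → (∀ s r c → Z (extend s r c)) → ∀ c′ → Z c′
    by-extension Z z (S′ , R′) = subst Z (cong₂ _,_ (E.extend-restrict S′) (V.extend-restrict R′))
                                  (z (lookup S′ ε) (lookup R′ x) (E.restrict S′ , V.restrict R′))

    module Forests (acyclicG : AcyclicGraph G) where

      acyclic-pendant : AcyclicGraph G′
      acyclic-pendant S′ =
        Restriction.acyclic-lift S′ (E.restrict S′) (λ f → sym (lookup∘tabulate (λ f → lookup S′ (κ f)) f)) acyclicG

      private
        module Extended (s : Bool) (S : SpanSub G) = Restriction (E.extend s S) S (E.lookup-extend-embed s S)
        module ExtendedRoots (s r : Bool) (S : SpanSub G) (R : Subset n) =
          Extended.RootsOf s S (lookup (V.extend r R)) (lookup R) (V.lookup-extend-embed r R)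

      forest-isolated : ∀ r S R → IsRootedForest G′ (extend false r (S , R)) ⇔ (r ≡ true × IsRootedForest G (S , R))
      forest-isolated r S R = mk⇔
        (λ f → let (x-root , roots) = ExtendedRoots.uniqueRoot-isolated⇒ false r S R (E.lookup-extend-new false S)
                                         (rootedForest⇒uniqueRoot f)
               in trans (sym (V.lookup-extend-new r R)) x-root , uniqueRoot⇒rootedForest (acyclicG S) roots)
        (λ (r≡true , f) → uniqueRoot⇒rootedForest (acyclic-pendant _)
           (ExtendedRoots.uniqueRoot-isolated⇐ false r S R (E.lookup-extend-new false S)
              (trans (V.lookup-extend-new r R) r≡true) (rootedForest⇒uniqueRoot f)))

      forest-attached : ∀ c → IsRootedForest G′ (extend true false c) ⇔ IsRootedForest G c
      forest-attached (S , R) = mk⇔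
        (λ f → uniqueRoot⇒rootedForest (acyclicG S)
                 (proj₂ (uniqueRoot-attached⇒ ε∈ (lookup R) spec (rootedForest⇒uniqueRoot f))))
        (λ f → uniqueRoot⇒rootedForest (acyclic-pendant _)
                 (uniqueRoot-attached⇐ ε∈ (lookup R) spec (λ (x-root , _) → x-unmarked x-root) (rootedForest⇒uniqueRoot f)))
        where
        x-unmarked : lookup (V.extend false R) x ≢ true
        x-unmarked x-root = false≢true (trans (sym (V.lookup-extend-new false R)) x-root)
        spec : ∀ w → lookup R w ≡ true ⇔ ((w ≡ y × lookup (V.extend false R) x ≡ true) ⊎ lookup R w ≡ true)
        spec w = mk⇔ inj₂ λ { (inj₁ (_ , x-root)) → ⊥-elim (x-unmarked x-root) ; (inj₂ w∈R) → w∈R }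
        open ExtendedRoots true false S R
        ε∈ : lookup (E.extend true S) ε ≡ true
        ε∈ = E.lookup-extend-new true S

      forest-attached-root : ∀ S R → IsRootedForest G′ (extend true true (S , R)) ⇔
                               (lookup R y ≡ false × IsRootedForest G (S , R [ y ]≔ true))
      forest-attached-root S R = mk⇔
        (λ f → let (not-both , roots) = uniqueRoot-attached⇒ ε∈ ρ* spec (rootedForest⇒uniqueRoot f)
               in ¬-not (λ y∈R → not-both (V.lookup-extend-new true R , y∈R)) ,
                  uniqueRoot⇒rootedForest (acyclicG S) roots)
        (λ (y∉R , f) → uniqueRoot⇒rootedForest (acyclic-pendant _)
           (uniqueRoot-attached⇐ ε∈ ρ* spec (λ (_ , y∈R) → false≢true (trans (sym y∉R) y∈R)) (rootedForest⇒uniqueRoot f)))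
        where
        open ExtendedRoots true true S R
        ε∈ : lookup (E.extend true S) ε ≡ true
        ε∈ = E.lookup-extend-new true S
        ρ* : Fin n → Bool
        ρ* = lookup (R [ y ]≔ true)
        spec : ∀ w → ρ* w ≡ true ⇔ ((w ≡ y × lookup (V.extend true R) x ≡ true) ⊎ lookup R w ≡ true)
        spec w with w ≟ y
        ... | yes refl = mk⇔ (λ _ → inj₁ (refl , V.lookup-extend-new true R)) (λ _ → lookup∘update y R true)
        ... | no w≢y   = mk⇔ (λ ρ*w → inj₂ (trans (sym (lookup∘update′ w≢y R true)) ρ*w))
                             λ { (inj₁ (w≡y , _)) → ⊥-elim (w≢y w≡y)
                               ; (inj₂ w∈R)       → trans (lookup∘update′ w≢y R true) w∈R }

      connected-x-ι : ∀ s S v → Connected G′ (E.extend s S) x (ι v) ⇔ (s ≡ true × Connected G S y v)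
      connected-x-ι s S v = mk⇔ (to′ s) λ { (refl , y~v) →
        Extended.Attached.connected-unretract true S (E.lookup-extend-new true S) retract-x (retract-ι v) y~v }
        where
        to′ : ∀ s → Connected G′ (E.extend s S) x (ι v) → s ≡ true × Connected G S y v
        to′ false (_ , x→v) = ⊥-elim (ι≢x v (Extended.Isolated.walk-from-x false S (E.lookup-extend-new false S) x→v))
        to′ true x~v = refl , Extended.connected-retract true S retract-x (retract-ι v) x~v

      x∈extend⁺ : ∀ R → x ∈ V.extend true R
      x∈extend⁺ R = lookup⇒[]= x _ (V.lookup-extend-new true R)

      x∈extend⁻ : ∀ {r R} → x ∈ V.extend r R → r ≡ true
      x∈extend⁻ {r} {R} x∈ = trans (sym (V.lookup-extend-new r R)) ([]=⇒lookup x∈)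

      ι∈extend⁺ : ∀ {r R u} → u ∈ R → ι u ∈ V.extend r R
      ι∈extend⁺ {r} {R} {u} u∈ = lookup⇒[]= (ι u) _ (trans (V.lookup-extend-embed r R u) ([]=⇒lookup u∈))

      ι∈extend⁻ : ∀ {r R u} → ι u ∈ V.extend r R → u ∈ R
      ι∈extend⁻ {r} {R} {u} ιu∈ = lookup⇒[]= u R (trans (sym (V.lookup-extend-embed r R u)) ([]=⇒lookup ιu∈))

      move-root : Candidate G → Candidate G′
      move-root (S , R) = extend true true (S , R [ y ]≔ false)

      private
        reset : ∀ {R : Subset n} {b} b′ → lookup R y ≡ b → (R [ y ]≔ b′) [ y ]≔ b ≡ R
        reset {R} b′ Ry≡b = trans ([]≔-idempotent R y) (trans (cong (R [ y ]≔_) (sym Ry≡b)) ([]≔-lookup R y))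

      move-root-injective : InjectiveOn (λ (_ , R) → y ∈ R) move-root
      move-root-injective {S , R} {T , Q} y∈R y∈Q eq =
        let (_ , _ , eq′) = extend-injective eq in
        cong₂ _,_ (cong proj₁ eq′)
          (trans (sym (reset {R} false ([]=⇒lookup y∈R)))
            (trans (cong (λ c → proj₂ c [ y ]≔ true) eq′) (reset {Q} false ([]=⇒lookup y∈Q))))

      forest-move-root : ∀ {S R} → y ∈ R → IsRootedForest G (S , R) → IsRootedForest G′ (move-root (S , R))
      forest-move-root {S} {R} y∈R f = from (forest-attached-root S (R [ y ]≔ false))
        (lookup∘update y R false , subst (λ Q → IsRootedForest G (S , Q)) (sym (reset {R} false ([]=⇒lookup y∈R))) f)

      move-root-onto : ∀ {S R} → IsRootedForest G′ (extend true true (S , R)) →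
                       Image (λ c → IsRootedForest G c × y ∈ proj₂ c) move-root (extend true true (S , R))
      move-root-onto {S} {R} f = let (y∉R , f′) = to (forest-attached-root S R) f in
        (S , R [ y ]≔ true) , (f′ , lookup⇒[]= y _ (lookup∘update y R true)) ,
        cong (λ Q → extend true true (S , Q)) (reset {R} true y∉R)

      private
        extend-≢ˢ : ∀ {r r′} c c′ → extend false r c ≢ extend true r′ c′
        extend-≢ˢ {r} {r′} c c′ eq = false≢true (proj₁ (extend-injective {false} {r} {c} {true} {r′} {c′} eq))

        extend-≢ʳ : ∀ {s} c c′ → extend s false c ≢ extend s true c′
        extend-≢ʳ {s} c c′ eq = false≢true (proj₁ (proj₂ (extend-injective {s} {false} {c} {s} {true} {c′} eq)))

        extend-injectiveᶜ : ∀ {s r} {Q : Candidate G → Set} → InjectiveOn Q (extend s r)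
        extend-injectiveᶜ {s} {r} {a = c} {c′} _ _ eq = proj₂ (proj₂ (extend-injective {s} {r} {c} {s} {r} {c′} eq))

      count-fxx : ∀ {k l} → IsCount (IsRootedForest G) k → IsCount (IsForestIJ G y y) l →
                  IsCount (IsForestIJ G′ x x) (k + l)
      count-fxx countF countY = count-onto₂ (extend false true) move-root countF countY
        extend-injectiveᶜ (λ (_ , _ , y∈R) (_ , _ , y∈Q) → move-root-injective y∈R y∈Q)
        (λ c (S , R) → extend-≢ˢ c (S , R [ y ]≔ false))
        (λ (S , R) f → from (forest-isolated true S R) (refl , f) , connected-refl , x∈extend⁺ R)
        (λ (S , R) (f , _ , y∈R) → forest-move-root y∈R f , connected-refl , x∈extend⁺ (R [ y ]≔ false))
        (by-extension _ onto)
        where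
        onto : ∀ s r c → IsForestIJ G′ x x (extend s r c) →
               Image (IsRootedForest G) (extend false true) (extend s r c) ⊎
               Image (IsForestIJ G y y) move-root (extend s r c)
        onto s r (S , R) (f , _ , x∈) with x∈extend⁻ {r} {R} x∈
        onto false _ (S , R) (f , _ , _) | refl = inj₁ ((S , R) , proj₂ (to (forest-isolated true S R) f) , refl)
        onto true  _ (S , R) (f , _ , _) | refl =
          let (c′ , (f′ , y∈) , eq) = move-root-onto {S} {R} f in inj₂ (c′ , (f′ , connected-refl , y∈) , eq)

      count-fxι : ∀ {j k} → IsCount (IsForestIJ G y j) k → IsCount (IsForestIJ G′ x (ι j)) k
      count-fxι {j} countY = count-onto move-root countY
        (λ (_ , _ , y∈R) (_ , _ , y∈Q) → move-root-injective y∈R y∈Q)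
        (λ (S , R) (f , y~j , y∈R) →
          forest-move-root y∈R f , from (connected-x-ι true S j) (refl , y~j) , x∈extend⁺ (R [ y ]≔ false))
        (by-extension _ onto)
        where
        onto : ∀ s r c → IsForestIJ G′ x (ι j) (extend s r c) → Image (IsForestIJ G y j) move-root (extend s r c)
        onto s r (S , R) (f , x~j , x∈) with x∈extend⁻ {r} {R} x∈ | to (connected-x-ι s S j) x~j
        ... | refl | refl , y~j = let (c′ , (f′ , y∈) , eq) = move-root-onto {S} {R} f in c′ , (f′ , y~j , y∈) , eq

      count-forests : ∀ {k l} → IsCount (IsRootedForest G) k → IsCount (IsForestIJ G y y) l →
                      IsCount (IsRootedForest G′) (k + (k + l))
      count-forests {k} {l} countF countY = count-⇔ (count-⊎ isolated attached disjoint)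
        λ c′ → mk⇔ (λ { (inj₁ ((S , R) , f , refl)) → from (forest-isolated true S R) (refl , f) ; (inj₂ (f , _)) → f })
                   (by-extension (λ c′ → IsRootedForest G′ c′ → Isolated c′ ⊎ Attached c′) split c′)
        where
        Isolated : Candidate G′ → Set
        Isolated = Image (IsRootedForest G) (extend false true)

        Attached : Candidate G′ → Set
        Attached (S′ , R′) = IsRootedForest G′ (S′ , R′) × lookup S′ ε ≡ true

        isolated : IsCount Isolated k
        isolated = count-image (extend false true) countF extend-injectiveᶜ

        attached : IsCount Attached (k + l)
        attached = count-onto₂ (extend true false) move-root countF countY
          extend-injectiveᶜ (λ (_ , _ , y∈R) (_ , _ , y∈Q) → move-root-injective y∈R y∈Q)
          (λ c (S , R) → extend-≢ʳ c (S , R [ y ]≔ false))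
          (λ c f → from (forest-attached c) f , E.lookup-extend-new true (proj₁ c))
          (λ (S , R) (f , _ , y∈R) → forest-move-root y∈R f , E.lookup-extend-new true S)
          (by-extension _ onto)
          where
          onto : ∀ s r c → Attached (extend s r c) →
                 Image (IsRootedForest G) (extend true false) (extend s r c) ⊎
                 Image (IsForestIJ G y y) move-root (extend s r c)
          onto s r (S , R) (f , ε∈) with trans (sym (E.lookup-extend-new s S)) ε∈
          onto true false (S , R) (f , _) | refl = inj₁ ((S , R) , to (forest-attached (S , R)) f , refl)
          onto true true  (S , R) (f , _) | refl =
            let (c′ , (f′ , y∈) , eq) = move-root-onto {S} {R} f in inj₂ (c′ , (f′ , connected-refl , y∈) , eq)

        disjoint : ∀ c′ → Isolated c′ → Attached c′ → ⊥
        disjoint _ ((S , _) , _ , refl) (_ , ε∈) = false≢true (trans (sym (E.lookup-extend-new false S)) ε∈)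

        split : ∀ s r c → IsRootedForest G′ (extend s r c) → Isolated (extend s r c) ⊎ Attached (extend s r c)
        split false r (S , R) f with to (forest-isolated r S R) f
        ... | refl , f′ = inj₁ ((S , R) , f′ , refl)
        split true r (S , R) f = inj₂ (f , E.lookup-extend-new true S)

      private
        y-unrooted : ∀ {S R} → IsRootedForest G′ (extend true true (S , R)) → ¬ y ∈ R
        y-unrooted {S} {R} f y∈R = false≢true (trans (sym (proj₁ (to (forest-attached-root S R) f))) ([]=⇒lookup y∈R))

      count-fιyιj : ∀ {j k} → IsCount (IsForestIJ G y j) k → IsCount (IsForestIJ G′ (ι y) (ι j)) (k + k)
      count-fιyιj {j} countY = count-onto₂ (extend false true) (extend true false) countY countY
        extend-injectiveᶜ extend-injectiveᶜ (λ c c′ → extend-≢ˢ c c′)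
        (λ (S , R) (f , y~j , y∈R) →
          from (forest-isolated true S R) (refl , f) , Extended.connected-lift false S y~j , ι∈extend⁺ y∈R)
        (λ (S , R) (f , y~j , y∈R) →
          from (forest-attached (S , R)) f , Extended.connected-lift true S y~j , ι∈extend⁺ y∈R)
        (by-extension _ onto)
        where
        onto : ∀ s r c → IsForestIJ G′ (ι y) (ι j) (extend s r c) →
               Image (IsForestIJ G y j) (extend false true) (extend s r c) ⊎
               Image (IsForestIJ G y j) (extend true false) (extend s r c)
        onto false r (S , R) (f , y~j , y∈) with to (forest-isolated r S R) f
        ... | refl , f′ = inj₁ ((S , R) , (f′ , Extended.connected-unlift false S y~j , ι∈extend⁻ y∈) , refl)
        onto true false (S , R) (f , y~j , y∈) =
          inj₂ ((S , R) , (to (forest-attached (S , R)) f , Extended.connected-unlift true S y~j , ι∈extend⁻ y∈) , refl)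
        onto true true (S , R) (f , _ , y∈) = ⊥-elim (y-unrooted {S} {R} f (ι∈extend⁻ y∈))

      count-fιyx : ∀ {k} → IsCount (IsForestIJ G y y) k → IsCount (IsForestIJ G′ (ι y) x) k
      count-fιyx countY = count-onto (extend true false) countY extend-injectiveᶜ
        (λ (S , R) (f , _ , y∈R) →
          from (forest-attached (S , R)) f ,
          connected-sym (from (connected-x-ι true S y) (refl , connected-refl)) ,
          ι∈extend⁺ y∈R)
        (by-extension _ onto)
        where
        onto : ∀ s r c → IsForestIJ G′ (ι y) x (extend s r c) → Image (IsForestIJ G y y) (extend true false) (extend s r c)
        onto s r (S , R) (f , y~x , y∈) with to (connected-x-ι s S y) (connected-sym y~x)
        onto true false (S , R) (f , _ , y∈) | refl , _ =
          (S , R) , (to (forest-attached (S , R)) f , connected-refl , ι∈extend⁻ y∈) , refl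
        onto true true (S , R) (f , _ , y∈) | refl , _ = ⊥-elim (y-unrooted {S} {R} f (ι∈extend⁻ y∈))

      module _ {f : Fin n → ℕ} (f-count : ∀ j → IsFIJ G y j (f j)) where

        module _ {f′ : Fin (suc n) → ℕ} (f′-count : ∀ v → IsFIJ G′ x v (f′ v)) where

          leaf-fxx : ∀ {k} → IsCount (IsRootedForest G) k → f′ x ≡ k + f y
          leaf-fxx forests = count-unique (f′-count x) (count-fxx forests (f-count y))

          leaf-others : sumExcept x f′ ≡ f y + sumExcept y f
          leaf-others = begin
            sumExcept x f′           ≡⟨ sumExcept-new vertex-ext f′ ⟩
            ∑ (λ j → f′ (ι j))       ≡⟨ ∑-cong (λ j → count-unique (f′-count (ι j)) (count-fxι (f-count j))) ⟩
            ∑ f                      ≡⟨ ∑-split y f ⟩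
            f y + sumExcept y f      ∎
            where open ≡-Reasoning

        module _ {f′ : Fin (suc n) → ℕ} (f′-count : ∀ v → IsFIJ G′ (ι y) v (f′ v)) where

          support-f : ∀ j → f′ (ι j) ≡ f j + f j
          support-f j = count-unique (f′-count (ι j)) (count-fιyιj (f-count j))

          support-others : sumExcept (ι y) f′ ≡ f y + (sumExcept y f + sumExcept y f)
          support-others = begin
            sumExcept (ι y) f′                              ≡⟨ sumExcept-embed vertex-ext y f′ ⟩
            f′ x + sumExcept y (λ j → f′ (ι j))             ≡⟨ cong₂ _+_ (count-unique (f′-count x) (count-fιyx (f-count y)))
                                                                          (sumExcept-cong y support-f) ⟩
            f y + sumExcept y (λ j → f j + f j)             ≡⟨ cong (f y +_) (sumExcept-+ y f f) ⟩
            f y + (sumExcept y f + sumExcept y f)           ∎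
            where open ≡-Reasoning


module Graphs where

  open import Data.Nat using (ℕ; zero; suc; _+_)
  open import Data.Bool using (true)
  open import Data.Fin using (Fin; zero; suc; inject₁; fromℕ; cast)
  open import Data.Fin.Properties using (suc-injective; inject₁-injective; fromℕ≢inject₁; cast-involutive)
  open import Data.Fin.Subset using (_∈_)
  open import Data.Vec using ([]; _∷_; here)
  open import Data.List using ([]; _∷_; length; tabulate; lookup)
  open import Data.List.Properties using (length-tabulate; lookup-tabulate)
  open import Data.Product using (∃-syntax; _×_; _,_; proj₁; proj₂)
  open import Data.Sum using (_⊎_; inj₁; inj₂)
  import Data.Sum as Sum
  open import Relation.Binary.PropositionalEquality
  open import Function.Bundles using (mk⇔)
  open Counting
  open Connectivity
  open RootedForests
  open OnePointExtensions
  open Pendants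

  suc-extension : ∀ {k} → OnePointExtension k (suc k)
  suc-extension = record
    { embed = suc ; new = zero ; embed-injective = suc-injective ; embed≢new = λ _ ()
    ; view = λ { zero → inj₁ refl ; (suc i) → inj₂ (i , refl) } }

  last-extension : ∀ {k} → OnePointExtension k (suc k)
  last-extension {k} = record
    { embed = inject₁ ; new = fromℕ k ; embed-injective = inject₁-injective
    ; embed≢new = λ i eq → fromℕ≢inject₁ (sym eq) ; view = last-view }
    where
    last-view : ∀ {k} (i : Fin (suc k)) → i ≡ fromℕ k ⊎ ∃[ j ] i ≡ inject₁ j
    last-view {zero}  zero    = inj₁ refl
    last-view {suc k} zero    = inj₂ (zero , refl)
    last-view {suc k} (suc i) with last-view i
    ... | inj₁ refl       = inj₁ refl
    ... | inj₂ (j , refl) = inj₂ (suc j , refl)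

  cast-extension : ∀ {k k′ l l′} → .(l ≡ k) → .(l′ ≡ k′) → OnePointExtension k k′ → OnePointExtension l l′
  cast-extension l≡k l′≡k′ ext = record
    { embed = embed′ ; new = cast (sym l′≡k′) new
    ; embed-injective = λ {i} {j} eq → cast-injective l≡k (embed-injective (cast-injective (sym l′≡k′) eq))
    ; embed≢new = λ i eq → embed≢new (cast l≡k i) (cast-injective (sym l′≡k′) eq)
    ; view = view′ }
    where
    open OnePointExtension ext
    cast-injective : ∀ {m n} .(eq : m ≡ n) {i j : Fin m} → cast eq i ≡ cast eq j → i ≡ j
    cast-injective eq {i} {j} ci≡cj =
      trans (sym (cast-involutive (sym eq) eq i)) (trans (cong (cast (sym eq)) ci≡cj) (cast-involutive (sym eq) eq j))
    embed′ : Fin _ → Fin _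
    embed′ i = cast (sym l′≡k′) (embed (cast l≡k i))
    view′ : ∀ i → i ≡ cast (sym l′≡k′) new ⊎ ∃[ j ] i ≡ embed′ j
    view′ i with view (cast l′≡k′ i)
    ... | inj₁ eq       = inj₁ (trans (sym (cast-involutive (sym l′≡k′) l′≡k′ i)) (cong (cast (sym l′≡k′)) eq))
    ... | inj₂ (j , eq) = inj₂ (cast (sym l≡k) j ,
            trans (sym (cast-involutive (sym l′≡k′) l′≡k′ i))
                  (cong (cast (sym l′≡k′)) (trans eq (cong embed (sym (cast-involutive l≡k (sym l≡k) j))))))

  record EdgeLabelling {n} (G : Graph n) (k : ℕ) : Set where
    field
      label : Fin k → Fin n × Fin n
      size : length (edges G) ≡ k
      endpoints-label : ∀ e → endpoints G e ≡ label (cast size e)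

  pendant-from-labelling :
    ∀ {n k k′} {G′ : Graph (suc n)} {G : Graph n} (L′ : EdgeLabelling G′ k′) (L : EdgeLabelling G k)
    (V : OnePointExtension n (suc n)) (E : OnePointExtension k k′) (y : Fin n) →
    let open OnePointExtension V using () renaming (embed to ι; new to x)
        open OnePointExtension E using () renaming (embed to κ; new to ε)
        open EdgeLabelling using (label) in
    (∀ i → label L′ (κ i) ≡ (ι (proj₁ (label L i)) , ι (proj₂ (label L i)))) →
    label L′ ε ≡ (x , ι y) ⊎ label L′ ε ≡ (ι y , x) →
    Pendant G′ G
  pendant-from-labelling {G′ = G′} L′ L V E y label-κ label-ε = record
    { vertex-ext = V
    ; edge-ext = cast-extension (size L) (size L′) E
    ; y = y
    ; κ-endpoints = λ e → trans (endpoints-label L′ _)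
        (trans (cong (label L′) (cast-involutive (size L′) (sym (size L′)) _))
          (trans (label-κ (cast (size L) e)) (cong (λ (u , v) → ι u , ι v) (sym (endpoints-label L e)))))
    ; ε-joins = Sum.map (trans endpoints-ε) (trans endpoints-ε) label-ε }
    where
    open EdgeLabelling
    open OnePointExtension V using () renaming (embed to ι)
    open OnePointExtension E using () renaming (new to ε)
    endpoints-ε : endpoints G′ (cast (sym (size L′)) ε) ≡ label L′ ε
    endpoints-ε = trans (endpoints-label L′ (cast (sym (size L′)) ε))
                        (cong (label L′) (cast-involutive (size L′) (sym (size L′)) ε))

  tabulate-labelling : ∀ {n k} (f : Fin k → Fin n × Fin n) → EdgeLabelling (graph (tabulate f)) k
  tabulate-labelling f = record
    { label = f
    ; size = length-tabulate f
    ; endpoints-label = λ e → trans (cong (lookup (tabulate f)) (sym (cast-involutive _ (length-tabulate f) e)))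
                                    (lookup-tabulate f (cast (length-tabulate f) e)) }

  path-labelling : ∀ m → EdgeLabelling (pathGraph (suc m)) m
  path-labelling m = tabulate-labelling λ i → inject₁ i , suc i

  T-label : ∀ m → Fin (2 + m) → Fin (3 + m) × Fin (3 + m)
  T-label m zero             = zero , suc (suc zero)
  T-label m (suc zero)       = suc zero , suc (suc zero)
  T-label m (suc (suc i))    = suc (suc (inject₁ i)) , suc (suc (suc i))

  T-labelling : ∀ m → EdgeLabelling (TGraph m) (2 + m)
  T-labelling m = record
    { label = T-label m
    ; size = cong (2 +_) (length-tabulate f)
    ; endpoints-label = λ { zero → refl ; (suc zero) → refl ; (suc (suc e)) → EdgeLabelling.endpoints-label (tabulate-labelling f) e } }
    where
    f : Fin m → Fin (3 + m) × Fin (3 + m)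
    f i = suc (suc (inject₁ i)) , suc (suc (suc i))

  path-pendant : ∀ m → Pendant (pathGraph (suc (suc m))) (pathGraph (suc m))
  path-pendant m = pendant-from-labelling (path-labelling (suc m)) (path-labelling m) suc-extension suc-extension
    zero (λ _ → refl) (inj₁ refl)

  T-pendant-path : ∀ m → Pendant (TGraph m) (pathGraph (suc (suc m)))
  T-pendant-path m = pendant-from-labelling (T-labelling m) (path-labelling (suc m)) suc-extension suc-extension
    (suc zero) (λ { zero → refl ; (suc _) → refl }) (inj₁ refl)

  T-pendant-T : ∀ m → Pendant (TGraph (suc m)) (TGraph m)
  T-pendant-T m = pendant-from-labelling (T-labelling (suc m)) (T-labelling m) last-extension last-extension
    (fromℕ (2 + m)) (λ { zero → refl ; (suc zero) → refl ; (suc (suc _)) → refl }) (inj₂ refl)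

  acyclic-path : ∀ m → AcyclicGraph (pathGraph (suc m))
  acyclic-path zero    S u []       w _ = refl
  acyclic-path zero    S u (() ∷ _) _ _
  acyclic-path (suc m) = Leaf.Forests.acyclic-pendant (path-pendant m) (acyclic-path m)

  acyclic-T : ∀ m → AcyclicGraph (TGraph m)
  acyclic-T m = Leaf.Forests.acyclic-pendant (T-pendant-path m) (acyclic-path (suc m))

  forests-P₁ : IsCount (IsRootedForest (pathGraph 1)) 1
  forests-P₁ = count-⇔ (count-single ([] , true ∷ [])) λ c → mk⇔ (λ { refl → forest }) (only c)
    where
    forest : IsRootedForest (pathGraph 1) ([] , true ∷ [])
    forest = acyclic-path 0 [] , λ { zero → zero , here , connected-refl , λ { zero _ _ → refl } }
    only : ∀ c → IsRootedForest (pathGraph 1) c → c ≡ ([] , true ∷ [])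
    only ([] , r ∷ []) (_ , roots) with roots zero
    ... | zero , here , _ = refl

  f₀₀-P₁ : IsCount (IsForestIJ (pathGraph 1) zero zero) 1
  f₀₀-P₁ = count-⇔ forests-P₁ λ c → mk⇔ (λ f → f , connected-refl , root-zero f) proj₁
    where
    root-zero : ∀ {c} → IsRootedForest (pathGraph 1) c → zero ∈ proj₂ c
    root-zero (_ , roots) with roots zero
    ... | zero , zero∈R , _ = zero∈R


module GoldenForm where

  open import Data.Integer
  open import Data.Integer.Properties
  open import Data.Integer.Tactic.RingSolver using (solve-∀)
  open import Relation.Binary.PropositionalEquality
  open ≤-Reasoning

  golden : ℤ → ℤ → ℤ
  golden x y = x * x - x * y - y * y

  golden-factor : ∀ a b p x →
    (x * a - p * b) * (x * a - x * b + p * b) ≡ x * x * golden a b - b * b * golden p x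
  golden-factor = ring
    where
    ring : ∀ a b p x → (x * a - p * b) * (x * a - x * b + p * b)
                      ≡ x * x * (a * a - a * b - b * b) - b * b * (p * p - p * x - x * x)
    ring = solve-∀

  golden-step : ∀ a b → golden (a + (a + b)) (a + b) ≡ golden a b
  golden-step = ring
    where
    ring : ∀ a b → (a + (a + b)) * (a + (a + b)) - (a + (a + b)) * (a + b) - (a + b) * (a + b)
                   ≡ a * a - a * b - b * b
    ring = solve-∀

  i≤+∣i∣ : ∀ i → i ≤ + ∣ i ∣
  i≤+∣i∣ (+ _)    = ≤-refl
  i≤+∣i∣ -[1+ _ ] = -≤+

  -i≤+∣i∣ : ∀ i → - i ≤ + ∣ i ∣
  -i≤+∣i∣ i = subst (λ k → - i ≤ + k) (∣-i∣≡∣i∣ i) (i≤+∣i∣ (- i))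

  neg-*-1 : ∀ i → i ≡ - (i * -1ℤ)
  neg-*-1 = solve-∀

  *-nonPos-nonNeg : ∀ {u v} → u ≤ 0ℤ → 0ℤ ≤ v → u * v ≤ 0ℤ
  *-nonPos-nonNeg {u} {v} u≤0 0≤v = begin
    u * v  ≤⟨ *-monoʳ-≤-nonNeg v {{nonNegative 0≤v}} u≤0 ⟩
    0ℤ * v ≡⟨ *-zeroˡ v ⟩
    0ℤ     ∎

  *-nonNeg-nonNeg : ∀ {u v} → 0ℤ ≤ u → 0ℤ ≤ v → 0ℤ ≤ u * v
  *-nonNeg-nonNeg {u} {v} 0≤u 0≤v = begin
    0ℤ     ≡⟨ *-zeroˡ v ⟨
    0ℤ * v ≤⟨ *-monoʳ-≤-nonNeg v {{nonNegative 0≤v}} 0≤u ⟩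
    u * v  ∎

  module _ {a b p x : ℤ} (0≤x : 0ℤ ≤ x) (0≤b : 0ℤ ≤ b) (b≤a : b ≤ a) where

    private
      0≤b*b : 0ℤ ≤ b * b
      0≤b*b = *-nonNeg-nonNeg 0≤b 0≤b

      0≤x*[a-b] : 0ℤ ≤ x * a - x * b
      0≤x*[a-b] = i≤j⇒0≤j-i (*-monoˡ-≤-nonNeg x {{nonNegative 0≤x}} b≤a)

      0≤x*a : 0ℤ ≤ x * a
      0≤x*a = *-nonNeg-nonNeg 0≤x (≤-trans 0≤b b≤a)

      x*x*-mono : ∀ {i j} → i ≤ j → x * x * i ≤ x * x * j
      x*x*-mono = *-monoˡ-≤-nonNeg (x * x) {{nonNegative (*-nonNeg-nonNeg 0≤x 0≤x)}}

    bounded-below : golden p x ≤ -1ℤ → x * a ≤ p * b → b * b ≤ x * x * + ∣ golden a b ∣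
    bounded-below g≤-1 xa≤pb = begin
      b * b                      ≡⟨ neg-*-1 (b * b) ⟩
      - (b * b * -1ℤ)            ≤⟨ neg-mono-≤ (*-monoˡ-≤-nonNeg (b * b) {{nonNegative 0≤b*b}} g≤-1) ⟩
      - (b * b * golden p x)     ≤⟨ neg-mono-≤ (i-j≤0⇒i≤j (subst (_≤ 0ℤ) (golden-factor a b p x) product≤0)) ⟩
      - (x * x * golden a b)     ≡⟨ neg-distribʳ-* (x * x) (golden a b) ⟩
      x * x * - golden a b       ≤⟨ x*x*-mono (-i≤+∣i∣ (golden a b)) ⟩
      x * x * + ∣ golden a b ∣   ∎
      where
      product≤0 : (x * a - p * b) * (x * a - x * b + p * b) ≤ 0ℤ
      product≤0 = *-nonPos-nonNeg (i≤j⇒i-j≤0 xa≤pb)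
                    (+-mono-≤ 0≤x*[a-b] (≤-trans 0≤x*a xa≤pb))

    bounded-above : 0ℤ ≤ p → 1ℤ ≤ golden p x → p * b ≤ x * a → b * b ≤ x * x * + ∣ golden a b ∣
    bounded-above 0≤p 1≤g pb≤xa = begin
      b * b                 ≡⟨ *-identityʳ (b * b) ⟨
      b * b * 1ℤ            ≤⟨ *-monoˡ-≤-nonNeg (b * b) {{nonNegative 0≤b*b}} 1≤g ⟩
      b * b * golden p x    ≤⟨ 0≤i-j⇒j≤i (subst (0ℤ ≤_) (golden-factor a b p x) 0≤product) ⟩
      x * x * golden a b    ≤⟨ x*x*-mono (i≤+∣i∣ (golden a b)) ⟩
      x * x * + ∣ golden a b ∣ ∎
      where
      0≤product : 0ℤ ≤ (x * a - p * b) * (x * a - x * b + p * b)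
      0≤product = *-nonNeg-nonNeg (i≤j⇒0≤j-i pb≤xa)
                    (+-mono-≤ 0≤x*[a-b] (*-nonNeg-nonNeg 0≤p 0≤b))


module PhiCut where

  open import Data.Nat as ℕ using (suc)
  import Data.Nat.Properties as ℕ
  open import Data.Nat.Coprimality using (1-coprimeTo)
  import Data.Nat.Coprimality as Coprime
  open import Data.Integer as ℤ using (ℤ; +_; 0ℤ; 1ℤ; -1ℤ)
  import Data.Integer.Properties as ℤ
  open import Data.Integer.Tactic.RingSolver using (solve-∀)
  open import Data.Rational as ℚ using (ℚ; mkℚ; ↥_; ↧_; _<_; _*_; _+_; 1ℚ; toℚᵘ)
  open import Data.Rational.Properties as ℚ
    using (normalize-coprime; toℚᵘ-mono-<; toℚᵘ-cancel-<; toℚᵘ-homo-*; toℚᵘ-homo-+)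
  import Data.Rational.Unnormalised as ℚᵘ
  import Data.Rational.Unnormalised.Properties as ℚᵘ
  open import Data.Product using (_×_; _,_)
  open import Data.Sum using (_⊎_; inj₁; inj₂)
  open import Relation.Binary.PropositionalEquality
  open GoldenForm using (golden)

  toℚᵘ-toℚ : ∀ k → toℚᵘ (toℚ k) ≡ ℚᵘ.mkℚᵘ (+ k) 0
  toℚᵘ-toℚ k = cong toℚᵘ (normalize-coprime (Coprime.sym (1-coprimeTo k)))

  toℚᵘ-*toℚ : ∀ p k → toℚᵘ (p * toℚ k) ℚᵘ.≃ toℚᵘ p ℚᵘ.* ℚᵘ.mkℚᵘ (+ k) 0
  toℚᵘ-*toℚ p k = subst (λ t → toℚᵘ (p * toℚ k) ℚᵘ.≃ toℚᵘ p ℚᵘ.* t) (toℚᵘ-toℚ k) (toℚᵘ-homo-* p (toℚ k))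

  *toℚ<toℚ : ∀ p k l → ↥ p ℤ.* + k ℤ.< ↧ p ℤ.* + l → p * toℚ k < toℚ l
  *toℚ<toℚ p@(mkℚ P d _) k l Pk<Dl = toℚᵘ-cancel-<
    (ℚᵘ.<-respˡ-≃ (ℚᵘ.≃-sym (toℚᵘ-*toℚ p k)) (subst (_ ℚᵘ.<_) (sym (toℚᵘ-toℚ l)) (ℚᵘ.*<* cross)))
    where
    cross : (P ℤ.* + k) ℤ.* + 1 ℤ.< + l ℤ.* + suc (d ℕ.* 1)
    cross = subst₂ ℤ._<_ (sym (ℤ.*-identityʳ _))
              (trans (ℤ.*-comm (↧ p) (+ l)) (cong (λ t → + l ℤ.* + suc t) (sym (ℕ.*-identityʳ d)))) Pk<Dl

  toℚ<*toℚ : ∀ q k l → ↧ q ℤ.* + l ℤ.< ↥ q ℤ.* + k → toℚ l < q * toℚ k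
  toℚ<*toℚ q@(mkℚ Q e _) k l El<Qk = toℚᵘ-cancel-<
    (ℚᵘ.<-respʳ-≃ (ℚᵘ.≃-sym (toℚᵘ-*toℚ q k)) (subst (ℚᵘ._< _) (sym (toℚᵘ-toℚ l)) (ℚᵘ.*<* cross)))
    where
    cross : + l ℤ.* + suc (e ℕ.* 1) ℤ.< (Q ℤ.* + k) ℤ.* + 1
    cross = subst₂ ℤ._<_ (trans (ℤ.*-comm (↧ q) (+ l)) (cong (λ t → + l ℤ.* + suc t) (sym (ℕ.*-identityʳ e))))
              (sym (ℤ.*-identityʳ _)) El<Qk

  -- In ℚᵘ the numerators and denominators of p * p and p + 1 are polynomials in those of p.
  sqᵘ succᵘ : ℚ → ℚᵘ.ℚᵘ
  sqᵘ p = toℚᵘ p ℚᵘ.* toℚᵘ p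
  succᵘ p = toℚᵘ p ℚᵘ.+ ℚᵘ.1ℚᵘ

  golden-cross : ∀ p → ℚᵘ.↥ sqᵘ p ℤ.* ℚᵘ.↧ succᵘ p ℤ.- ℚᵘ.↥ succᵘ p ℤ.* ℚᵘ.↧ sqᵘ p
                       ≡ golden (↥ p) (↧ p) ℤ.* ↧ p
  golden-cross (mkℚ P d _) =
    trans (cong₂ (λ s t → P ℤ.* P ℤ.* s ℤ.- (P ℤ.* 1ℤ ℤ.+ 1ℤ ℤ.* D) ℤ.* t)
                 (cong (λ k → + suc k) (ℕ.*-identityʳ d)) (ℤ.pos-* (suc d) (suc d)))
          (ring P D)
    where
    D : ℤ
    D = + suc d
    ring : ∀ P D → P ℤ.* P ℤ.* D ℤ.- (P ℤ.* 1ℤ ℤ.+ 1ℤ ℤ.* D) ℤ.* (D ℤ.* D)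
                   ≡ (P ℤ.* P ℤ.- P ℤ.* D ℤ.- D ℤ.* D) ℤ.* D
    ring = solve-∀

  toℚᵘ-1ℚ : toℚᵘ 1ℚ ≡ ℚᵘ.1ℚᵘ
  toℚᵘ-1ℚ = toℚᵘ-toℚ 1

  toℚᵘ-sq : ∀ p → toℚᵘ (p * p) ℚᵘ.≃ sqᵘ p
  toℚᵘ-sq p = toℚᵘ-homo-* p p

  toℚᵘ-succ : ∀ p → toℚᵘ (p + 1ℚ) ℚᵘ.≃ succᵘ p
  toℚᵘ-succ p = subst (λ t → toℚᵘ (p + 1ℚ) ℚᵘ.≃ toℚᵘ p ℚᵘ.+ t) toℚᵘ-1ℚ (toℚᵘ-homo-+ p 1ℚ)

  BelowPhi-golden : ∀ p → BelowPhi p → ↥ p ℤ.≤ 0ℤ ⊎ golden (↥ p) (↧ p) ℤ.≤ -1ℤ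
  BelowPhi-golden p@(mkℚ _ _ _) (inj₁ p≤0) = inj₁ (ℤ.nonPositive⁻¹ (↥ p) {{ℚ.nonPositive p≤0}})
  BelowPhi-golden p (inj₂ p²<p+1) = inj₂ (ℤ.i<j⇒i≤pred[j] (ℤ.*-cancelʳ-<-nonNeg {j = 0ℤ} (↧ p) g*D<0*D))
    where
    B : ℤ
    B = ℚᵘ.↥ succᵘ p ℤ.* ℚᵘ.↧ sqᵘ p
    A<B : ℚᵘ.↥ sqᵘ p ℤ.* ℚᵘ.↧ succᵘ p ℤ.< B
    A<B = ℚᵘ.drop-*<* (ℚᵘ.<-respʳ-≃ (toℚᵘ-succ p) (ℚᵘ.<-respˡ-≃ (toℚᵘ-sq p) (toℚᵘ-mono-< p²<p+1)))
    g*D<0*D : golden (↥ p) (↧ p) ℤ.* ↧ p ℤ.< 0ℤ ℤ.* ↧ p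
    g*D<0*D = subst₂ ℤ._<_ (golden-cross p) (trans (ℤ.+-inverseʳ B) (sym (ℤ.*-zeroˡ (↧ p))))
                (ℤ.+-monoˡ-< (ℤ.- B) A<B)

  AbovePhi-golden : ∀ q → AbovePhi q → 0ℤ ℤ.≤ ↥ q × 1ℤ ℤ.≤ golden (↥ q) (↧ q)
  AbovePhi-golden q@(mkℚ _ _ _) (0<q , q+1<q²) =
    ℤ.<⇒≤ (ℤ.positive⁻¹ (↥ q) {{ℚ.positive 0<q}}) ,
    ℤ.i<j⇒suc[i]≤j (ℤ.*-cancelʳ-<-nonNeg {i = 0ℤ} (↧ q) 0*D<g*D)
    where
    B : ℤ
    B = ℚᵘ.↥ succᵘ q ℤ.* ℚᵘ.↧ sqᵘ q
    B<A : B ℤ.< ℚᵘ.↥ sqᵘ q ℤ.* ℚᵘ.↧ succᵘ q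
    B<A = ℚᵘ.drop-*<* (ℚᵘ.<-respˡ-≃ (toℚᵘ-succ q) (ℚᵘ.<-respʳ-≃ (toℚᵘ-sq q) (toℚᵘ-mono-< q+1<q²)))
    0*D<g*D : 0ℤ ℤ.* ↧ q ℤ.< golden (↥ q) (↧ q) ℤ.* ↧ q
    0*D<g*D = subst₂ ℤ._<_ (trans (ℤ.+-inverseʳ B) (sym (ℤ.*-zeroˡ (↧ q)))) (golden-cross q)
                (ℤ.+-monoˡ-< (ℤ.- B) B<A)


module Convergence where

  open import Data.Nat as ℕ using (ℕ; zero; suc; z≤n; s≤s)
  import Data.Nat.Properties as ℕ
  open import Data.Integer as ℤ using (ℤ; +_; +≤+; ∣_∣)
  import Data.Integer.Properties as ℤ
  open import Data.Rational using (↥_; ↧_; ↧ₙ_)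
  open import Data.Product using (_,_)
  open import Data.Sum using (inj₁; inj₂)
  open import Relation.Binary.PropositionalEquality
  open GoldenForm
  open PhiCut

  module Recurrence (a b : ℕ → ℕ)
                    (a-suc : ∀ m → a (suc m) ≡ a m ℕ.+ b (suc m))
                    (b-suc : ∀ m → b (suc m) ≡ a m ℕ.+ b m)
                    (1≤a₀ : 1 ℕ.≤ a 0) (b₀≤a₀ : b 0 ℕ.≤ a 0) where

    1≤a : ∀ m → 1 ℕ.≤ a m
    1≤a zero    = 1≤a₀
    1≤a (suc m) rewrite a-suc m = ℕ.≤-trans (1≤a m) (ℕ.m≤m+n (a m) (b (suc m)))

    b≤a : ∀ m → b m ℕ.≤ a m
    b≤a zero    = b₀≤a₀
    b≤a (suc m) rewrite a-suc m = ℕ.m≤n+m (b (suc m)) (a m)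

    m≤b : ∀ m → m ℕ.≤ b m
    m≤b zero    = z≤n
    m≤b (suc m) rewrite b-suc m = ℕ.+-mono-≤ (1≤a m) (m≤b m)

    c : ℤ
    c = golden (+ a 0) (+ b 0)

    golden-invariant : ∀ m → golden (+ a m) (+ b m) ≡ c
    golden-invariant zero    = refl
    golden-invariant (suc m) = begin
      golden (+ a (suc m)) (+ b (suc m))
        ≡⟨ cong₂ golden (trans (cong +_ (a-suc m)) (trans (ℤ.pos-+ (a m) (b (suc m))) (cong (ℤ._+_ (+ a m)) +b′)))
                        +b′ ⟩
      golden (+ a m ℤ.+ (+ a m ℤ.+ + b m)) (+ a m ℤ.+ + b m)  ≡⟨ golden-step (+ a m) (+ b m) ⟩
      golden (+ a m) (+ b m)                                 ≡⟨ golden-invariant m ⟩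
      c ∎
      where
      open ≡-Reasoning
      +b′ : + b (suc m) ≡ + a m ℤ.+ + b m
      +b′ = trans (cong +_ (b-suc m)) (ℤ.pos-+ (a m) (b m))

    b-bounded : ∀ {n x} → 1 ℕ.≤ b n → + b n ℤ.* + b n ℤ.≤ + x ℤ.* + x ℤ.* + ∣ c ∣ →
                b n ℕ.≤ x ℕ.* x ℕ.* ∣ c ∣
    b-bounded {n} {x} 1≤b b²≤x²∣c∣ =
      ℕ.≤-trans (ℕ.m≤m*n (b n) (b n) {{ℕ.>-nonZero 1≤b}}) (ℤ.drop‿+≤+ (subst₂ ℤ._≤_ +b² +x²∣c∣ b²≤x²∣c∣))
      where
      +b² : + b n ℤ.* + b n ≡ + (b n ℕ.* b n)
      +b² = sym (ℤ.pos-* (b n) (b n))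
      +x²∣c∣ : + x ℤ.* + x ℤ.* + ∣ c ∣ ≡ + (x ℕ.* x ℕ.* ∣ c ∣)
      +x²∣c∣ = sym (trans (ℤ.pos-* (x ℕ.* x) ∣ c ∣) (cong (ℤ._* + ∣ c ∣) (ℤ.pos-* x x)))

    below-ratio : ∀ p → BelowPhi p → ∀ n → ↧ₙ p ℕ.* ↧ₙ p ℕ.* ∣ c ∣ ℕ.< b n →
                  ↥ p ℤ.* + b n ℤ.< ↧ p ℤ.* + a n
    below-ratio p below n big with BelowPhi-golden p below
    ... | inj₁ ↥p≤0 = ℤ.≤-<-trans (*-nonPos-nonNeg ↥p≤0 (+≤+ z≤n))
                        (subst (ℤ._< ↧ p ℤ.* + a n) (ℤ.*-zeroʳ (↧ p)) (ℤ.*-monoˡ-<-pos (↧ p) (ℤ.+<+ (1≤a n))))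
    ... | inj₂ g≤-1 = ℤ.≰⇒> λ Da≤Pb → ℕ.<⇒≱ big (b-bounded {n} {↧ₙ p} (ℕ.≤-trans (s≤s z≤n) big)
            (subst (λ g → + b n ℤ.* + b n ℤ.≤ ↧ p ℤ.* ↧ p ℤ.* + ∣ g ∣) (golden-invariant n)
              (bounded-below {a = + a n} {p = ↥ p} {x = ↧ p} (+≤+ z≤n) (+≤+ z≤n) (+≤+ (b≤a n)) g≤-1 Da≤Pb)))

    above-ratio : ∀ q → AbovePhi q → ∀ n → ↧ₙ q ℕ.* ↧ₙ q ℕ.* ∣ c ∣ ℕ.< b n →
                  ↧ q ℤ.* + a n ℤ.< ↥ q ℤ.* + b n
    above-ratio q above n big with AbovePhi-golden q above
    ... | 0≤↥q , 1≤g = ℤ.≰⇒> λ Qb≤Ea → ℕ.<⇒≱ big (b-bounded {n} {↧ₙ q} (ℕ.≤-trans (s≤s z≤n) big)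
            (subst (λ g → + b n ℤ.* + b n ℤ.≤ ↧ q ℤ.* ↧ q ℤ.* + ∣ g ∣) (golden-invariant n)
              (bounded-above {a = + a n} {p = ↥ q} {x = ↧ q} (+≤+ z≤n) (+≤+ z≤n) (+≤+ (b≤a n)) 0≤↥q 1≤g Qb≤Ea)))

    ratio-tends-to-φ : RatioTendsToPhi a b
    ratio-tends-to-φ p q below above = suc (Bp ℕ.+ Bq) , λ n N≤n →
      let N≤b = ℕ.≤-trans N≤n (m≤b n) in
      ℕ.≤-trans (s≤s z≤n) N≤b ,
      *toℚ<toℚ p (b n) (a n) (below-ratio p below n (ℕ.≤-trans (s≤s (ℕ.m≤m+n Bp Bq)) N≤b)) ,
      toℚ<*toℚ q (b n) (a n) (above-ratio q above n (ℕ.≤-trans (s≤s (ℕ.m≤n+m Bq Bp)) N≤b))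
      where
      Bp Bq : ℕ
      Bp = ↧ₙ p ℕ.* ↧ₙ p ℕ.* ∣ c ∣
      Bq = ↧ₙ q ℕ.* ↧ₙ q ℕ.* ∣ c ∣

open import Data.Nat using (ℕ; suc; _+_)
open import Data.Fin using (Fin; zero; suc; fromℕ)
open import Data.Product using (_×_; _,_)
open import Relation.Binary.PropositionalEquality using (_≡_)

module LeafChain (Forests : ℕ → ℕ → Set) (a b : ℕ → ℕ)
             (forests₀ : Forests 0 (a 0 + b 0))
             (forests-suc : ∀ {m k} → Forests m k → Forests (suc m) (k + (k + a m)))
             (a-suc-forests : ∀ {m k} → Forests m k → a (suc m) ≡ k + a m)
             (b-suc : ∀ m → b (suc m) ≡ a m + b m) where

  open import Data.Nat using (zero)
  open import Data.Nat.Properties using (+-comm)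
  open import Relation.Binary.PropositionalEquality using (subst; cong; cong₂; trans; sym)

  forests : ∀ m → Forests m (a m + b m)
  forests zero    = forests₀
  forests (suc m) = subst (Forests (suc m)) eq (forests-suc (forests m))
    where
    eq : (a m + b m) + ((a m + b m) + a m) ≡ a (suc m) + b (suc m)
    eq = trans (+-comm (a m + b m) _) (sym (cong₂ _+_ (a-suc-forests (forests m)) (b-suc m)))

  a-suc : ∀ m → a (suc m) ≡ a m + b (suc m)
  a-suc m = trans (a-suc-forests (forests m)) (trans (+-comm (a m + b m) (a m)) (cong (a m +_) (sym (b-suc m))))

module Corollary
  (fP : (m : ℕ) → Fin (suc m) → Fin (suc m) → ℕ) (fP-count : ∀ m i j → IsFIJ (pathGraph (suc m)) i j (fP m i j))
  (fT : (m : ℕ) → Fin (3 + m) → Fin (3 + m) → ℕ) (fT-count : ∀ m i j → IsFIJ (TGraph m) i j (fT m i j)) where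

  open import Data.Nat using (zero; _*_; _≤_; z≤n; s≤s)
  open import Data.Nat.Properties using (≤-reflexive)
  open import Data.Nat.Tactic.RingSolver using (solve-∀)
  open import Relation.Binary.PropositionalEquality
  open ≡-Reasoning
  open Counting using (count-unique)
  open Pendants using (module Leaf)
  open Graphs
  open Convergence using (module Recurrence)

  private
    module PP m = Leaf.Forests (path-pendant m) (acyclic-path m)
    module TP m = Leaf.Forests (T-pendant-path m) (acyclic-path (suc m))
    module TT m = Leaf.Forests (T-pendant-T m) (acyclic-T m)

  a b : ℕ → ℕ
  a m = fP m zero zero
  b m = sumExcept zero (fP m zero)

  a₀ : a 0 ≡ 1
  a₀ = count-unique (fP-count 0 zero zero) f₀₀-P₁

  b₀ : b 0 ≡ 0
  b₀ = refl

  b-suc : ∀ m → b (suc m) ≡ a m + b m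
  b-suc m = PP.leaf-others m (fP-count m zero) (fP-count (suc m) zero)

  ForestsP : ℕ → ℕ → Set
  ForestsP m = IsCount (IsRootedForest (pathGraph (suc m)))

  forestsP₀ : ForestsP 0 (a 0 + b 0)
  forestsP₀ = subst (IsCount _) (sym (cong₂ _+_ a₀ b₀)) forests-P₁

  forestsP-suc : ∀ {m k} → ForestsP m k → ForestsP (suc m) (k + (k + a m))
  forestsP-suc {m} forests = PP.count-forests m forests (fP-count m zero zero)

  a-suc-forestsP : ∀ {m k} → ForestsP m k → a (suc m) ≡ k + a m
  a-suc-forestsP {m} = PP.leaf-fxx m (fP-count m zero) (fP-count (suc m) zero)

  module PathChain = LeafChain ForestsP a b forestsP₀ forestsP-suc a-suc-forestsP b-suc

  c d : ℕ → ℕ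
  c m = sumExcept (suc (suc zero)) (fT m (suc (suc zero)))
  d m = fT m (suc (suc zero)) (suc (suc zero))

  d-closed : ∀ m → d m ≡ 4 * a m
  d-closed m = begin
    d m                        ≡⟨ TP.support-f m (fP-count (suc m) (suc zero)) (fT-count m (suc (suc zero))) (suc zero) ⟩
    f₁₁ + f₁₁                  ≡⟨ cong (λ u → u + u) (PP.support-f m (fP-count m zero) (fP-count (suc m) (suc zero)) zero) ⟩
    (a m + a m) + (a m + a m)  ≡⟨ ring (a m) ⟩
    4 * a m                    ∎
    where
    f₁₁ : ℕ
    f₁₁ = fP (suc m) (suc zero) (suc zero)
    ring : ∀ x → (x + x) + (x + x) ≡ 4 * x
    ring = solve-∀

  c-closed : ∀ m → c m ≡ 4 * (a m + b m)
  c-closed m = begin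
    c m                                     ≡⟨ TP.support-others m (fP-count (suc m) (suc zero)) (fT-count m (suc (suc zero))) ⟩
    f₁₁ + (s₁ + s₁)                         ≡⟨ cong₂ (λ u v → u + (v + v))
                                                 (PP.support-f m (fP-count m zero) (fP-count (suc m) (suc zero)) zero)
                                                 (PP.support-others m (fP-count m zero) (fP-count (suc m) (suc zero))) ⟩
    (a m + a m) + ((a m + (b m + b m)) + (a m + (b m + b m))) ≡⟨ ring (a m) (b m) ⟩
    4 * (a m + b m)                         ∎
    where
    f₁₁ s₁ : ℕ
    f₁₁ = fP (suc m) (suc zero) (suc zero)
    s₁ = sumExcept (suc zero) (fP (suc m) (suc zero))
    ring : ∀ x y → (x + x) + ((x + (y + y)) + (x + (y + y))) ≡ 4 * (x + y)
    ring = solve-∀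

  d₀ : d 0 ≡ 4
  d₀ = trans (d-closed 0) (cong (4 *_) a₀)

  c₀ : c 0 ≡ 4
  c₀ = trans (c-closed 0) (cong₂ (λ u v → 4 * (u + v)) a₀ b₀)

  a-suc² : ∀ m → a (suc m) ≡ a m + (a m + b m)
  a-suc² m = trans (PathChain.a-suc m) (cong (a m +_) (b-suc m))

  d-suc : ∀ m → d (suc m) ≡ c m + d m
  d-suc m = begin
    d (suc m)                     ≡⟨ d-closed (suc m) ⟩
    4 * a (suc m)                 ≡⟨ cong (4 *_) (a-suc² m) ⟩
    4 * (a m + (a m + b m))       ≡⟨ ring (a m) (b m) ⟩
    4 * (a m + b m) + 4 * a m     ≡⟨ cong₂ _+_ (c-closed m) (d-closed m) ⟨
    c m + d m                     ∎
    where
    ring : ∀ x y → 4 * (x + (x + y)) ≡ 4 * (x + y) + 4 * x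
    ring = solve-∀

  c-suc : ∀ m → c (suc m) ≡ c m + d (suc m)
  c-suc m = begin
    c (suc m)                                  ≡⟨ c-closed (suc m) ⟩
    4 * (a (suc m) + b (suc m))                ≡⟨ cong₂ (λ u v → 4 * (u + v)) (a-suc² m) (b-suc m) ⟩
    4 * ((a m + (a m + b m)) + (a m + b m))    ≡⟨ ring (a m) (b m) ⟩
    4 * (a m + b m) + 4 * (a m + (a m + b m))  ≡⟨ cong₂ _+_ (c-closed m) (cong (4 *_) (a-suc² m)) ⟨
    c m + 4 * a (suc m)                        ≡⟨ cong (c m +_) (d-closed (suc m)) ⟨
    c m + d (suc m)                            ∎
    where
    ring : ∀ x y → 4 * ((x + (x + y)) + (x + y)) ≡ 4 * (x + y) + 4 * (x + (x + y))
    ring = solve-∀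

  last : ∀ m → Fin (3 + m)
  last m = fromℕ (2 + m)

  aT bT : ℕ → ℕ
  aT m = fT m (last m) (last m)
  bT m = sumExcept (last m) (fT m (last m))

  bT-suc : ∀ m → bT (suc m) ≡ aT m + bT m
  bT-suc m = TT.leaf-others m (fT-count m (last m)) (fT-count (suc m) (last (suc m)))

  ForestsT : ℕ → ℕ → Set
  ForestsT m = IsCount (IsRootedForest (TGraph m))

  forestsT₀ : ForestsT 0 (aT 0 + bT 0)
  forestsT₀ = subst (IsCount _) eq (TP.count-forests 0 (PathChain.forests 1) (fP-count 1 (suc zero) (suc zero)))
    where
    forests-P₂ : a 1 + b 1 ≡ 3
    forests-P₂ = trans (cong₂ _+_ (a-suc² 0) (b-suc 0)) (cong₂ (λ u v → (u + (u + v)) + (u + v)) a₀ b₀)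
    f₁₁-P₂ : fP 1 (suc zero) (suc zero) ≡ 2
    f₁₁-P₂ = trans (PP.support-f 0 (fP-count 0 zero) (fP-count 1 (suc zero)) zero) (cong (λ u → u + u) a₀)
    eq : (a 1 + b 1) + ((a 1 + b 1) + fP 1 (suc zero) (suc zero)) ≡ aT 0 + bT 0
    eq = trans (cong₂ (λ r f → r + (r + f)) forests-P₂ f₁₁-P₂) (sym (cong₂ _+_ d₀ c₀))

  forestsT-suc : ∀ {m k} → ForestsT m k → ForestsT (suc m) (k + (k + aT m))
  forestsT-suc {m} forests = TT.count-forests m forests (fT-count m (last m) (last m))

  aT-suc-forestsT : ∀ {m k} → ForestsT m k → aT (suc m) ≡ k + aT m
  aT-suc-forestsT {m} = TT.leaf-fxx m (fT-count m (last m)) (fT-count (suc m) (last (suc m)))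

  module TChain = LeafChain ForestsT aT bT forestsT₀ forestsT-suc aT-suc-forestsT bT-suc

  open Recurrence using (ratio-tends-to-φ)

  ratio-P : RatioTendsToPhi a b
  ratio-P = ratio-tends-to-φ a b PathChain.a-suc b-suc (≤-reflexive (sym a₀)) (subst (_≤ a 0) (sym b₀) z≤n)

  ratio-T-last : RatioTendsToPhi aT bT
  ratio-T-last =
    ratio-tends-to-φ aT bT TChain.a-suc bT-suc (subst (1 ≤_) (sym d₀) (s≤s z≤n)) (≤-reflexive (trans c₀ (sym d₀)))

  ratio-T-3 : RatioTendsToPhi c d
  ratio-T-3 =
    ratio-tends-to-φ c d c-suc d-suc (subst (1 ≤_) (sym c₀) (s≤s z≤n)) (≤-reflexive (trans d₀ (sym c₀)))

corollary3 :
    (fP : (m : ℕ) → Fin (suc m) → Fin (suc m) → ℕ) →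
    (∀ m i j → IsFIJ (pathGraph (suc m)) i j (fP m i j)) →
    (fT : (m : ℕ) → Fin (3 + m) → Fin (3 + m) → ℕ) →
    (∀ m i j → IsFIJ (TGraph m) i j (fT m i j)) →
    RatioTendsToPhi (λ m → fP m zero zero) (λ m → sumExcept zero (fP m zero))
    × RatioTendsToPhi (λ m → fT m (fromℕ (2 + m)) (fromℕ (2 + m)))
                      (λ m → sumExcept (fromℕ (2 + m)) (fT m (fromℕ (2 + m))))
    × RatioTendsToPhi (λ m → sumExcept (suc (suc zero)) (fT m (suc (suc zero))))
                      (λ m → fT m (suc (suc zero)) (suc (suc zero)))
corollary3 fP fP-count fT fT-count = ratio-P , ratio-T-last , ratio-T-3
  where open Corollary fP fP-count fT fT-count
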